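{- In the OSW model described in the context, let $X$ be the number of directed 3-cycles in $G_n$ (sets of three distinct vertices with a cyclic orientation $u\to x\to y\to u$ all of whose arcs lie in $E$) that contain at least one long-range edge, i.e., an arc $(p,q)$ with $\{p,q\}\notin E'$. Then $\mathbb{E}[X]=\mathcal{O}(n^2/\log n)$.
   Context: Let $n\ge1$ be an integer, $V=\{u\in\mathbb{Z}^3:\sum_{i=1}^3|u_i|=n\}$, $E'=\{\{v,w\}\subset V: v\ne w,\ |v_i-w_i|\le1\ \forall 1\le i\le3\}$ (the undirected $n$-octahedral graph $G'_n=(V,E')$), and let $d_{uv}$ be the shortest-path distance in $G'_n$. For $u\in V$ let $Z_u=\left(\sum_{w\in V\setminus\{u\}}d_{uw}^{ -2}\right)^{ -1}$. The OSW graph $G_n=(V,E)$ is the random directed graph whose edge set $E$ contains (i) both directed edges $(u,v)$ and $(v,u)$ for every $\{u,v\}\in E'$, and (ii) for each $u\in V$, independently, one directed edge $(u,v)$ where $v\in V\setminus\{u\}$ is chosen with probability $Z_u d_{uv}^{ -2}$. -}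

module Defs where

open import Data.Bool using (Bool; true; false; _∧_; _∨_; not; T)
open import Data.Nat as ℕ using (ℕ; zero; suc; _≤ᵇ_; _≡ᵇ_)
open import Data.Integer as ℤ using (ℤ; +_; ∣_∣; _-_)
open import Data.Rational as ℚ using (ℚ; 0ℚ; 1ℚ; 1/_; ≢-nonZero)
open import Data.List using (List; []; _∷_; map; concatMap; foldr; filterᵇ; length; upTo)
open import Data.Bool.ListAction using (any)
open import Data.Product using (_×_; _,_)
open import Relation.Nullary using (yes; no)
open import Relation.Nullary.Decidable using (⌊_⌋)

Pt : Set
Pt = ℤ × ℤ × ℤ

norm1 : Pt → ℕ
norm1 (a , b , c) = ∣ a ∣ ℕ.+ ∣ b ∣ ℕ.+ ∣ c ∣

inV : ℕ → Pt → Bool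
inV n p = norm1 p ≡ᵇ n

rangeZ : ℕ → List ℤ
rangeZ n = map (λ i → + i - + n) (upTo (suc (n ℕ.+ n)))

Vs : ℕ → List Pt
Vs n = filterᵇ (inV n)
  (concatMap (λ a → concatMap (λ b → map (λ c → (a , b , c)) (rangeZ n)) (rangeZ n)) (rangeZ n))

eqZ : ℤ → ℤ → Bool
eqZ a b = ⌊ a ℤ.≟ b ⌋

eqPt : Pt → Pt → Bool
eqPt (a , b , c) (a' , b' , c') = eqZ a a' ∧ eqZ b b' ∧ eqZ c c'

closeZ : ℤ → ℤ → Bool
closeZ a b = ∣ a - b ∣ ≤ᵇ 1

adj'B : Pt → Pt → Bool
adj'B (a , b , c) (a' , b' , c') =
  not (eqPt (a , b , c) (a' , b' , c')) ∧ closeZ a a' ∧ closeZ b b' ∧ closeZ c c'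

data Walk (n : ℕ) : Pt → Pt → ℕ → Set where
  here : ∀ {v} → Walk n v v 0
  step : ∀ {u w v k} → T (adj'B u w) → T (inV n w) → Walk n w v k → Walk n u v (suc k)

IsDistance : ℕ → (Pt → Pt → ℕ) → Set
IsDistance n d = ∀ u v → T (inV n u) → T (inV n v) →
  Walk n u v (d u v) × (∀ k → Walk n u v k → d u v ℕ.≤ k)

sumQ : List ℚ → ℚ
sumQ = foldr ℚ._+_ 0ℚ

prodQ : List ℚ → ℚ
prodQ = foldr ℚ._*_ 1ℚ

-- d⁻² (only used for d ≥ 1)
invSq : ℕ → ℚ
invSq zero = 0ℚ
invSq (suc k) = + 1 ℚ./ (suc k ℕ.* suc k)

recip : ℚ → ℚ
recip p with p ℚ.≟ 0ℚ
... | yes _ = 0ℚ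
... | no p≢0 = 1/_ p {{≢-nonZero p≢0}}

others : ℕ → Pt → List Pt
others n u = filterᵇ (λ v → not (eqPt u v)) (Vs n)

Zc : ℕ → (Pt → Pt → ℕ) → Pt → ℚ
Zc n d u = recip (sumQ (map (λ w → invSq (d u w)) (others n u)))

prob : ℕ → (Pt → Pt → ℕ) → Pt → Pt → ℚ
prob n d u v = Zc n d u ℚ.* invSq (d u v)

-- an outcome: for each u ∈ V, the chosen target (list of pairs (u , v))
Assign : Set
Assign = List (Pt × Pt)

assigns : List Pt → (Pt → List Pt) → List Assign
assigns [] f = [] ∷ []
assigns (u ∷ us) f = concatMap (λ v → map ((u , v) ∷_) (assigns us f)) (f u)

outcomes : ℕ → List Assign
outcomes n = assigns (Vs n) (others n)

weight : ℕ → (Pt → Pt → ℕ) → Assign → ℚ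
weight n d a = prodQ (map (λ { (u , v) → prob n d u v }) a)

arcB : Assign → Pt → Pt → Bool
arcB a p q = adj'B p q ∨ any (λ { (u , v) → eqPt u p ∧ eqPt v q }) a

longB : Pt → Pt → Bool
longB p q = not (adj'B p q)

cycleB : Assign → Pt → Pt → Pt → Bool
cycleB a u x y =
  not (eqPt u x) ∧ not (eqPt x y) ∧ not (eqPt y u) ∧
  arcB a u x ∧ arcB a x y ∧ arcB a y u ∧
  (longB u x ∨ longB x y ∨ longB y u)

triples : List Pt → List (Pt × Pt × Pt)
triples vs = concatMap (λ u → concatMap (λ x → map (λ y → (u , x , y)) vs) vs) vs

countOrd : ℕ → Assign → ℕ
countOrd n a = length (filterᵇ (λ { (u , x , y) → cycleB a u x y }) (triples (Vs n)))

-- X: each directed 3-cycle corresponds to exactly 3 ordered triples (its rotations)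
Xval : ℕ → Assign → ℚ
Xval n a = + countOrd n a ℚ./ 3

EX : ℕ → (Pt → Pt → ℕ) → ℚ
EX n d = sumQ (map (λ a → weight n d a ℚ.* Xval n a) (outcomes n))

module Submission where

-- Let K(s,t) = 𝟙[{s,t} ∈ E'] + p(s,t) bound the probability of the arc (s,t).
-- For distinct u, x, y the arcs of u → x → y → u are decided by three different
-- sources, so by independence of the product measure the cycle has probability
-- at most K(u,x) K(x,y) K(y,u), where a long-range arc, say y → u, contributes
-- p(y,u) instead of K(y,u) (cycle-mean).  Summing over ordered triples, rows of
-- K sum to at most 27 + 1, while p(y,u) ≤ Z_y ≤ 64 / ⌊log₂ n⌋ (prob-log): around
-- every vertex a dyadic family of walks in two coordinate directions gives
-- Σ_w d(y,w)⁻² ≥ (⌊log₂ n⌋ - 3) / 16 (spread-mass).  Together with |V| ≤ 18 n²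
-- this yields E[X] · ⌊log₂ n⌋ ≤ 3 · 28 · 28 · 64 · 18 n².

open import Defs
open import Data.Bool using (Bool; true; false; _∧_; _∨_; not; T; if_then_else_)
open import Data.Nat as ℕ using (ℕ; zero; suc; _≤_; _<_; _*_; z≤n; s≤s; _^_; ⌊_/2⌋)
open import Data.Nat.Logarithm using (⌊log₂_⌋; ⌊log₂⌋-mono-≤; ⌊log₂⌊n/2⌋⌋≡⌊log₂n⌋∸1)
open import Data.Nat.Induction using (<-rec)
import Data.Nat.Properties as ℕP
open import Data.Integer as ℤ using (ℤ; +_; -[1+_]; ∣_∣; 1ℤ; -1ℤ)
import Data.Integer.Properties as ℤP
open import Data.Rational as ℚ using (ℚ; _/_; 0ℚ; 1ℚ)
import Data.Rational.Properties as ℚP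
open import Data.Rational.Unnormalised as ℚᵘ using (mkℚᵘ)
import Data.Rational.Unnormalised.Properties as ℚᵘP
open import Data.List using (List; []; _∷_; map; concatMap; filterᵇ; length; _++_; upTo; applyUpTo)
import Data.List.Properties
open import Data.List.Membership.Propositional using (_∈_; _∉_; find)
open import Data.List.Membership.Propositional.Properties
open import Data.List.Relation.Unary.Any as Any using (here; there)
import Data.List.Relation.Unary.All as All
open import Data.List.Relation.Unary.AllPairs using ([]; _∷_)
open import Data.List.Relation.Unary.Unique.Propositional using (Unique)
import Data.List.Relation.Unary.Unique.Propositional.Properties as Unique
open import Data.Bool.Properties using (T-∧; T-≡; ∨-identityʳ; ∧-identityʳ; ∧-zeroʳ)
open import Data.Bool.ListAction using (any)
open import Function using (_∘_; Equivalence)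
open import Relation.Nullary using (¬_; yes; no)
open import Relation.Nullary.Decidable using (T?; toWitness; fromWitness)
open import Data.Product using (_×_; _,_; proj₁; proj₂; ∃)
open import Data.Sum using (inj₁; inj₂)
open import Data.Empty using (⊥; ⊥-elim)
open import Relation.Binary.PropositionalEquality
open import Data.Nat.Tactic.RingSolver using (solve-∀)
open import Data.Rational.Solver using (module +-*-Solver)
open import Data.Integer.Solver renaming (module +-*-Solver to ℤSolver)

open ℚP using (≤-refl; ≤-trans; ≤-reflexive; +-mono-≤)

frac : ℕ → ℕ → ℚ
frac a k = + a / suc k

ι : ℕ → ℚ
ι a = frac a 0

frac-ᵘ : ∀ a k → ℚ.toℚᵘ (frac a k) ℚᵘ.≃ mkℚᵘ (+ a) k
frac-ᵘ a k = ℚP.toℚᵘ-fromℚᵘ (mkℚᵘ (+ a) k)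

frac-≤ : ∀ a b c d → a ℕ.* suc d ≤ c ℕ.* suc b → frac a b ℚ.≤ frac c d
frac-≤ a b c d h = ℚP.toℚᵘ-cancel-≤
  (ℚᵘP.≤-respˡ-≃ (ℚᵘP.≃-sym (frac-ᵘ a b)) (ℚᵘP.≤-respʳ-≃ (ℚᵘP.≃-sym (frac-ᵘ c d))
    (ℚᵘ.*≤* (subst₂ ℤ._≤_ (ℤP.pos-* a (suc d)) (ℤP.pos-* c (suc b)) (ℤ.+≤+ h)))))

frac-≡ : ∀ a b c d → a ℕ.* suc d ≡ c ℕ.* suc b → frac a b ≡ frac c d
frac-≡ a b c d h = ℚP.toℚᵘ-injective (ℚᵘP.≃-trans (frac-ᵘ a b) (ℚᵘP.≃-trans
  (ℚᵘ.*≡* (trans (sym (ℤP.pos-* a (suc d))) (trans (cong +_ h) (ℤP.pos-* c (suc b)))))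
  (ℚᵘP.≃-sym (frac-ᵘ c d))))

frac-* : ∀ a b c d → frac a b ℚ.* frac c d ≡ frac (a ℕ.* c) (b ℕ.+ d ℕ.+ b ℕ.* d)
frac-* a b c d = ℚP.toℚᵘ-injective (ℚᵘP.≃-trans (ℚP.toℚᵘ-homo-* (frac a b) (frac c d))
  (ℚᵘP.≃-trans (ℚᵘP.*-cong (frac-ᵘ a b) (frac-ᵘ c d))
  (ℚᵘP.≃-trans (ℚᵘ.*≡* cross) (ℚᵘP.≃-sym (frac-ᵘ (a ℕ.* c) _)))))
  where
  denominators : ∀ a c b d → a ℕ.* c ℕ.* suc (d ℕ.+ b ℕ.* suc d) ≡ a ℕ.* c ℕ.* suc (b ℕ.+ d ℕ.+ b ℕ.* d)
  denominators = solve-∀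
  cross : (+ a ℤ.* + c) ℤ.* + suc (b ℕ.+ d ℕ.+ b ℕ.* d) ≡ + (a ℕ.* c) ℤ.* + (suc b ℕ.* suc d)
  cross = trans (cong (ℤ._* + suc (b ℕ.+ d ℕ.+ b ℕ.* d)) (sym (ℤP.pos-* a c)))
    (trans (sym (ℤP.pos-* (a ℕ.* c) _))
    (trans (cong +_ (sym (denominators a c b d))) (ℤP.pos-* (a ℕ.* c) (suc b ℕ.* suc d))))

ι-+ : ∀ a b → ι (a ℕ.+ b) ≡ ι a ℚ.+ ι b
ι-+ a b = ℚP.toℚᵘ-injective (ℚᵘP.≃-trans (frac-ᵘ (a ℕ.+ b) 0) (ℚᵘP.≃-trans (ℚᵘ.*≡* cross)
  (ℚᵘP.≃-sym (ℚᵘP.≃-trans (ℚP.toℚᵘ-homo-+ (ι a) (ι b)) (ℚᵘP.+-cong (frac-ᵘ a 0) (frac-ᵘ b 0))))))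
  where
  open ℤSolver
  cross : + (a ℕ.+ b) ℤ.* + 1 ≡ (+ a ℤ.* + 1 ℤ.+ + b ℤ.* + 1) ℤ.* + 1
  cross = trans (cong (ℤ._* + 1) (ℤP.pos-+ a b))
    (solve 2 (λ x y → (x :+ y) :* con (+ 1) := (x :* con (+ 1) :+ y :* con (+ 1)) :* con (+ 1)) refl (+ a) (+ b))

ι-* : ∀ a b → ι (a ℕ.* b) ≡ ι a ℚ.* ι b
ι-* a b = sym (frac-* a 0 b 0)

ι-mono : ∀ {a b} → a ≤ b → ι a ℚ.≤ ι b
ι-mono {a} {b} h = frac-≤ a 0 b 0 (subst₂ _≤_ (sym (ℕP.*-identityʳ a)) (sym (ℕP.*-identityʳ b)) h)

frac-nonneg : ∀ a k → 0ℚ ℚ.≤ frac a k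
frac-nonneg a k = frac-≤ 0 0 a k z≤n

*-nonneg : ∀ {a b} → 0ℚ ℚ.≤ a → 0ℚ ℚ.≤ b → 0ℚ ℚ.≤ a ℚ.* b
*-nonneg {a} {b} 0≤a 0≤b =
  ℚP.nonNegative⁻¹ _ {{ℚP.nonNeg*nonNeg⇒nonNeg a {{ℚ.nonNegative 0≤a}} b {{ℚ.nonNegative 0≤b}}}}

+-nonneg : ∀ {a b} → 0ℚ ℚ.≤ a → 0ℚ ℚ.≤ b → 0ℚ ℚ.≤ a ℚ.+ b
+-nonneg 0≤a 0≤b = +-mono-≤ 0≤a 0≤b

*-monoˡ : ∀ {a b} c → 0ℚ ℚ.≤ c → a ℚ.≤ b → c ℚ.* a ℚ.≤ c ℚ.* b
*-monoˡ c 0≤c = ℚP.*-monoˡ-≤-nonNeg c {{ℚ.nonNegative 0≤c}}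

*-monoʳ : ∀ {a b} c → 0ℚ ℚ.≤ c → a ℚ.≤ b → a ℚ.* c ℚ.≤ b ℚ.* c
*-monoʳ c 0≤c = ℚP.*-monoʳ-≤-nonNeg c {{ℚ.nonNegative 0≤c}}

*-mono : ∀ {a b c d} → 0ℚ ℚ.≤ a → 0ℚ ℚ.≤ c → a ℚ.≤ b → c ℚ.≤ d → a ℚ.* c ℚ.≤ b ℚ.* d
*-mono 0≤a 0≤c a≤b c≤d =
  ≤-trans (*-monoʳ _ 0≤c a≤b) (*-monoˡ _ (≤-trans 0≤a a≤b) c≤d)

recip-nonneg : ∀ q → 0ℚ ℚ.≤ q → 0ℚ ℚ.≤ recip q
recip-nonneg q 0≤q with q ℚ.≟ 0ℚ
... | yes _ = ≤-refl
... | no q≢0 = ℚP.<⇒≤ (ℚP.positive⁻¹ _ {{ℚP.1/pos⇒pos q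
                 {{ℚP.nonNeg∧nonZero⇒pos q {{ℚ.nonNegative 0≤q}} {{ℚ.≢-nonZero q≢0}}}}}})

recip-* : ∀ q → recip q ℚ.* q ℚ.≤ 1ℚ
recip-* q with q ℚ.≟ 0ℚ
... | yes _ = ≤-trans (≤-reflexive (ℚP.*-zeroˡ q)) (frac-nonneg 1 0)
... | no q≢0 = ≤-reflexive (ℚP.*-inverseˡ q {{ℚ.≢-nonZero q≢0}})

invSq-nonneg : ∀ k → 0ℚ ℚ.≤ invSq k
invSq-nonneg zero = ≤-refl
invSq-nonneg (suc k) = frac-nonneg 1 (k ℕ.+ k ℕ.* suc k)

invSq-≤1 : ∀ k → invSq k ℚ.≤ 1ℚ
invSq-≤1 zero = frac-nonneg 1 0
invSq-≤1 (suc k) = frac-≤ 1 (k ℕ.+ k ℕ.* suc k) 1 0 (s≤s z≤n)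

invSq-antitone : ∀ {a b} → 1 ≤ a → a ≤ b → invSq b ℚ.≤ invSq a
invSq-antitone {suc a} {suc b} _ a≤b =
  frac-≤ 1 (b ℕ.+ b ℕ.* suc b) 1 (a ℕ.+ a ℕ.* suc a)
    (subst₂ _≤_ (sym (ℕP.*-identityˡ _)) (sym (ℕP.*-identityˡ _)) (ℕP.*-mono-≤ a≤b a≤b))

invSq-inverse : ∀ {m} → 1 ≤ m → ι (m ℕ.* m) ℚ.* invSq m ≡ 1ℚ
invSq-inverse {suc m} _ = trans (frac-* (suc m ℕ.* suc m) 0 1 (m ℕ.+ m ℕ.* suc m))
  (frac-≡ (suc m ℕ.* suc m ℕ.* 1) (0 ℕ.+ (m ℕ.+ m ℕ.* suc m) ℕ.+ 0 ℕ.* (m ℕ.+ m ℕ.* suc m)) 1 0 (cross m))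
  where
  cross : ∀ m → suc m ℕ.* suc m ℕ.* 1 ℕ.* 1 ≡
                1 ℕ.* suc (0 ℕ.+ (m ℕ.+ m ℕ.* suc m) ℕ.+ 0 ℕ.* (m ℕ.+ m ℕ.* suc m))
  cross = solve-∀

ind : Bool → ℚ
ind true = 1ℚ
ind false = 0ℚ

ind-nonneg : ∀ b → 0ℚ ℚ.≤ ind b
ind-nonneg true = frac-nonneg 1 0
ind-nonneg false = ≤-refl

ind-∧ : ∀ x y → ind (x ∧ y) ≡ ind x ℚ.* ind y
ind-∧ true y = sym (ℚP.*-identityˡ (ind y))
ind-∧ false y = sym (ℚP.*-zeroˡ (ind y))

ind-∨ : ∀ x y → ind (x ∨ y) ℚ.≤ ind x ℚ.+ ind y
ind-∨ true y = ≤-trans (≤-reflexive (sym (ℚP.+-identityʳ 1ℚ))) (+-mono-≤ ≤-refl (ind-nonneg y))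
ind-∨ false y = ≤-reflexive (sym (ℚP.+-identityˡ (ind y)))

ind-≤1 : ∀ b → ind b ℚ.≤ 1ℚ
ind-≤1 true = ≤-refl
ind-≤1 false = frac-nonneg 1 0

module _ {A : Set} where

  Σ : (A → ℚ) → List A → ℚ
  Σ f xs = sumQ (map f xs)

  Π : (A → ℚ) → List A → ℚ
  Π f xs = prodQ (map f xs)

  Σ-++ : ∀ (f : A → ℚ) xs ys → Σ f (xs ++ ys) ≡ Σ f xs ℚ.+ Σ f ys
  Σ-++ f [] ys = sym (ℚP.+-identityˡ _)
  Σ-++ f (x ∷ xs) ys = trans (cong (f x ℚ.+_) (Σ-++ f xs ys)) (sym (ℚP.+-assoc (f x) _ _))

  Σ-cong : ∀ {f g : A → ℚ} xs → (∀ x → x ∈ xs → f x ≡ g x) → Σ f xs ≡ Σ g xs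
  Σ-cong [] h = refl
  Σ-cong (x ∷ xs) h = cong₂ ℚ._+_ (h x (here refl)) (Σ-cong xs (λ y m → h y (there m)))

  Σ-mono : ∀ {f g : A → ℚ} xs → (∀ x → x ∈ xs → f x ℚ.≤ g x) → Σ f xs ℚ.≤ Σ g xs
  Σ-mono [] h = ≤-refl
  Σ-mono (x ∷ xs) h = +-mono-≤ (h x (here refl)) (Σ-mono xs (λ y m → h y (there m)))

  Σ-nonneg : ∀ {f : A → ℚ} xs → (∀ x → x ∈ xs → 0ℚ ℚ.≤ f x) → 0ℚ ℚ.≤ Σ f xs
  Σ-nonneg [] h = ≤-refl
  Σ-nonneg (x ∷ xs) h = +-nonneg (h x (here refl)) (Σ-nonneg xs (λ y m → h y (there m)))

  Σ-*ˡ : ∀ c (f : A → ℚ) xs → c ℚ.* Σ f xs ≡ Σ (λ x → c ℚ.* f x) xs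
  Σ-*ˡ c f [] = ℚP.*-zeroʳ c
  Σ-*ˡ c f (x ∷ xs) = trans (ℚP.*-distribˡ-+ c (f x) _) (cong (c ℚ.* f x ℚ.+_) (Σ-*ˡ c f xs))

  Σ-*ʳ : ∀ c (f : A → ℚ) xs → Σ f xs ℚ.* c ≡ Σ (λ x → f x ℚ.* c) xs
  Σ-*ʳ c f xs = trans (ℚP.*-comm _ c) (trans (Σ-*ˡ c f xs) (Σ-cong xs (λ x _ → ℚP.*-comm c (f x))))

  Σ-+ : ∀ (f g : A → ℚ) xs → Σ (λ x → f x ℚ.+ g x) xs ≡ Σ f xs ℚ.+ Σ g xs
  Σ-+ f g [] = refl
  Σ-+ f g (x ∷ xs) = trans (cong (f x ℚ.+ g x ℚ.+_) (Σ-+ f g xs)) (interchange (f x) (g x) _ _)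
    where
    open +-*-Solver
    interchange : ∀ a b c d → a ℚ.+ b ℚ.+ (c ℚ.+ d) ≡ a ℚ.+ c ℚ.+ (b ℚ.+ d)
    interchange = solve 4 (λ a b c d → a :+ b :+ (c :+ d) := a :+ c :+ (b :+ d)) refl

  Σ-zero : ∀ (xs : List A) → Σ (λ _ → 0ℚ) xs ≡ 0ℚ
  Σ-zero [] = refl
  Σ-zero (x ∷ xs) = trans (cong (0ℚ ℚ.+_) (Σ-zero xs)) (ℚP.+-identityˡ 0ℚ)

  Σ-const : ∀ c (xs : List A) → Σ (λ _ → c) xs ≡ ι (length xs) ℚ.* c
  Σ-const c [] = sym (ℚP.*-zeroˡ c)
  Σ-const c (x ∷ xs) = begin
    c ℚ.+ Σ (λ _ → c) xs          ≡⟨ cong₂ ℚ._+_ (sym (ℚP.*-identityˡ c)) (Σ-const c xs) ⟩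
    1ℚ ℚ.* c ℚ.+ ι (length xs) ℚ.* c ≡⟨ sym (ℚP.*-distribʳ-+ c 1ℚ (ι (length xs))) ⟩
    (1ℚ ℚ.+ ι (length xs)) ℚ.* c     ≡⟨ cong (ℚ._* c) (sym (ι-+ 1 (length xs))) ⟩
    ι (suc (length xs)) ℚ.* c ∎
    where open ≡-Reasoning

  Π-* : ∀ (f g : A → ℚ) xs → Π (λ x → f x ℚ.* g x) xs ≡ Π f xs ℚ.* Π g xs
  Π-* f g [] = sym (ℚP.*-identityˡ 1ℚ)
  Π-* f g (x ∷ xs) = trans (cong (f x ℚ.* g x ℚ.*_) (Π-* f g xs)) (interchange (f x) (g x) _ _)
    where
    open +-*-Solver
    interchange : ∀ a b c d → a ℚ.* b ℚ.* (c ℚ.* d) ≡ a ℚ.* c ℚ.* (b ℚ.* d)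
    interchange = solve 4 (λ a b c d → a :* b :* (c :* d) := a :* c :* (b :* d)) refl

  Π-nonneg : ∀ {f : A → ℚ} xs → (∀ x → x ∈ xs → 0ℚ ℚ.≤ f x) → 0ℚ ℚ.≤ Π f xs
  Π-nonneg [] h = frac-nonneg 1 0
  Π-nonneg (x ∷ xs) h = *-nonneg (h x (here refl)) (Π-nonneg xs (λ y m → h y (there m)))

  Π-mono : ∀ {f g : A → ℚ} xs → (∀ x → x ∈ xs → 0ℚ ℚ.≤ f x) → (∀ x → x ∈ xs → f x ℚ.≤ g x) →
           Π f xs ℚ.≤ Π g xs
  Π-mono [] h0 h = ≤-refl
  Π-mono (x ∷ xs) h0 h = *-mono (h0 x (here refl)) (Π-nonneg xs (λ y m → h0 y (there m)))
    (h x (here refl)) (Π-mono xs (λ y m → h0 y (there m)) (λ y m → h y (there m)))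

  Σ-sublist : ∀ (f : A → ℚ) R L → Unique R → (∀ r → r ∈ R → r ∈ L) → (∀ x → x ∈ L → 0ℚ ℚ.≤ f x) →
              Σ f R ℚ.≤ Σ f L
  Σ-sublist f [] L _ _ nonneg = Σ-nonneg L nonneg
  Σ-sublist f (r ∷ R) L (r∉R ∷ uniqR) sub nonneg with ∈-∃++ (sub r (here refl))
  ... | L₁ , L₂ , refl = ≤-trans (+-mono-≤ (≤-refl {f r}) (Σ-sublist f R (L₁ ++ L₂) uniqR sub′ nonneg′))
                                 (≤-reflexive move-r)
    where
    sub′ : ∀ x → x ∈ R → x ∈ L₁ ++ L₂
    sub′ x m with ∈-++⁻ L₁ (sub x (there m))
    ... | inj₁ m₁ = ∈-++⁺ˡ m₁
    ... | inj₂ (here refl) = ⊥-elim (All.lookup r∉R m refl)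
    ... | inj₂ (there m₂) = ∈-++⁺ʳ L₁ m₂
    nonneg′ : ∀ x → x ∈ L₁ ++ L₂ → 0ℚ ℚ.≤ f x
    nonneg′ x m with ∈-++⁻ L₁ m
    ... | inj₁ m₁ = nonneg x (∈-++⁺ˡ m₁)
    ... | inj₂ m₂ = nonneg x (∈-++⁺ʳ L₁ (there m₂))
    open +-*-Solver
    swap : ∀ a b c → a ℚ.+ (b ℚ.+ c) ≡ b ℚ.+ (a ℚ.+ c)
    swap = solve 3 (λ a b c → a :+ (b :+ c) := b :+ (a :+ c)) refl
    move-r : f r ℚ.+ Σ f (L₁ ++ L₂) ≡ Σ f (L₁ ++ r ∷ L₂)
    move-r = trans (cong (f r ℚ.+_) (Σ-++ f L₁ L₂))
      (trans (swap (f r) (Σ f L₁) (Σ f L₂)) (sym (Σ-++ f L₁ (r ∷ L₂))))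

Σ-map : ∀ {A B : Set} (f : B → ℚ) (g : A → B) xs → Σ f (map g xs) ≡ Σ (λ x → f (g x)) xs
Σ-map f g [] = refl
Σ-map f g (x ∷ xs) = cong (f (g x) ℚ.+_) (Σ-map f g xs)

Σ-concatMap : ∀ {A B : Set} (f : B → ℚ) (g : A → List B) xs →
              Σ f (concatMap g xs) ≡ Σ (λ x → Σ f (g x)) xs
Σ-concatMap f g [] = refl
Σ-concatMap f g (x ∷ xs) = trans (Σ-++ f (g x) (concatMap g xs)) (cong (Σ f (g x) ℚ.+_) (Σ-concatMap f g xs))

Σ-swap : ∀ {A B : Set} (f : A → B → ℚ) xs ys →
         Σ (λ a → Σ (f a) ys) xs ≡ Σ (λ b → Σ (λ a → f a b) xs) ys
Σ-swap f [] ys = sym (Σ-zero ys)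
Σ-swap f (x ∷ xs) ys = trans (cong (Σ (f x) ys ℚ.+_) (Σ-swap f xs ys)) (sym (Σ-+ (f x) _ ys))

Σ-filterᵇ : ∀ {A : Set} (P : A → Bool) (f : A → ℚ) xs →
            Σ (λ x → ind (P x) ℚ.* f x) xs ≡ Σ f (filterᵇ P xs)
Σ-filterᵇ P f [] = refl
Σ-filterᵇ P f (x ∷ xs) with P x
... | true = cong₂ ℚ._+_ (ℚP.*-identityˡ (f x)) (Σ-filterᵇ P f xs)
... | false = trans (cong₂ ℚ._+_ (ℚP.*-zeroˡ (f x)) (Σ-filterᵇ P f xs)) (ℚP.+-identityˡ _)

count-as-Σ : ∀ {A : Set} (P : A → Bool) xs → ι (length (filterᵇ P xs)) ≡ Σ (λ x → ind (P x)) xs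
count-as-Σ P xs = begin
  ι (length (filterᵇ P xs))                  ≡⟨ sym (ℚP.*-identityʳ _) ⟩
  ι (length (filterᵇ P xs)) ℚ.* 1ℚ           ≡⟨ sym (Σ-const 1ℚ (filterᵇ P xs)) ⟩
  Σ (λ _ → 1ℚ) (filterᵇ P xs)                ≡⟨ sym (Σ-filterᵇ P (λ _ → 1ℚ) xs) ⟩
  Σ (λ x → ind (P x) ℚ.* 1ℚ) xs              ≡⟨ Σ-cong xs (λ x _ → ℚP.*-identityʳ (ind (P x))) ⟩
  Σ (λ x → ind (P x)) xs ∎
  where open ≡-Reasoning

∈-filterᵇ⁺ : ∀ {A : Set} (P : A → Bool) {x xs} → x ∈ xs → T (P x) → x ∈ filterᵇ P xs
∈-filterᵇ⁺ P = ∈-filter⁺ (T? ∘ P)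

∈-filterᵇ⁻ : ∀ {A : Set} (P : A → Bool) {x xs} → x ∈ filterᵇ P xs → x ∈ xs × T (P x)
∈-filterᵇ⁻ P = ∈-filter⁻ (T? ∘ P)

unique-filterᵇ : ∀ {A : Set} (P : A → Bool) {xs} → Unique xs → Unique (filterᵇ P xs)
unique-filterᵇ P = Unique.filter⁺ (T? ∘ P)

unique-map : ∀ {A B : Set} (f : A → B) xs → (∀ x y → x ∈ xs → y ∈ xs → f x ≡ f y → x ≡ y) →
             Unique xs → Unique (map f xs)
unique-map f [] inj u = []
unique-map f (x ∷ xs) inj (x∉ ∷ u) =
  distinct xs x∉ (λ y m → inj x y (here refl) (there m)) ∷
  unique-map f xs (λ a b ma mb → inj a b (there ma) (there mb)) u
  where
  distinct : ∀ ys → All.All (λ y → ¬ x ≡ y) ys → (∀ y → y ∈ ys → f x ≡ f y → x ≡ y) →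
             All.All (λ z → ¬ f x ≡ z) (map f ys)
  distinct [] _ _ = All.[]
  distinct (y ∷ ys) (x≢y All.∷ x≢ys) h =
    (λ e → x≢y (h y (here refl) e)) All.∷ distinct ys x≢ys (λ z m → h z (there m))

unique-concatMap : ∀ {A B : Set} (f : A → List B) (key : B → A) xs →
  (∀ x z → z ∈ f x → key z ≡ x) → (∀ x → Unique (f x)) → Unique xs → Unique (concatMap f xs)
unique-concatMap f key [] hk hu u = []
unique-concatMap f key (x ∷ xs) hk hu (x∉ ∷ u) =
  Unique.++⁺ (hu x) (unique-concatMap f key xs hk hu u) disjoint
  where
  disjoint : ∀ {v} → ¬ (v ∈ f x × v ∈ concatMap f xs)
  disjoint {v} (m₁ , m₂) with find (∈-concatMap⁻ f {xs = xs} m₂)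
  ... | y , y∈xs , v∈fy = All.lookup x∉ y∈xs (trans (sym (hk x v m₁)) (hk y v v∈fy))

length-injection : ∀ {A B : Set} (f : A → B) xs ys → Unique xs →
  (∀ x y → x ∈ xs → y ∈ xs → f x ≡ f y → x ≡ y) → (∀ x → x ∈ xs → f x ∈ ys) →
  ι (length xs) ℚ.≤ ι (length ys)
length-injection f xs ys unique inj into = begin
  ι (length xs)               ≡⟨ sym (trans (Σ-const 1ℚ xs) (ℚP.*-identityʳ _)) ⟩
  Σ (λ _ → 1ℚ) xs             ≡⟨ sym (Σ-map (λ _ → 1ℚ) f xs) ⟩
  Σ (λ _ → 1ℚ) (map f xs)     ≤⟨ Σ-sublist (λ _ → 1ℚ) (map f xs) ys (unique-map f xs inj unique) sub
                                    (λ _ _ → frac-nonneg 1 0) ⟩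
  Σ (λ _ → 1ℚ) ys             ≡⟨ trans (Σ-const 1ℚ ys) (ℚP.*-identityʳ _) ⟩
  ι (length ys) ∎
  where
  open ℚP.≤-Reasoning
  sub : ∀ r → r ∈ map f xs → r ∈ ys
  sub r m with ∈-map⁻ f m
  ... | x , x∈ , refl = into x x∈

grid : ∀ {A B C : Set} → List A → List B → List C → List (A × B × C)
grid as bs cs = concatMap (λ a → concatMap (λ b → map (λ c → (a , b , c)) cs) bs) as

∈-concatMap-intro : ∀ {A B : Set} (f : A → List B) {x y xs} → y ∈ f x → x ∈ xs → y ∈ concatMap f xs
∈-concatMap-intro f h m = ∈-concatMap⁺ f (Any.map (λ { refl → h }) m)

∈-grid : ∀ {A B C : Set} {as bs cs} {a : A} {b : B} {c : C} → a ∈ as → b ∈ bs → c ∈ cs →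
         (a , b , c) ∈ grid as bs cs
∈-grid {as = as} {bs} {cs} {a} {b} {c} ma mb mc =
  ∈-concatMap-intro (λ a → concatMap (λ b → map (λ c → (a , b , c)) cs) bs)
    (∈-concatMap-intro (λ b → map (λ c → (a , b , c)) cs) (∈-map⁺ (λ c → (a , b , c)) mc) mb) ma

unique-grid : ∀ {A B C : Set} {as : List A} {bs : List B} {cs : List C} →
              Unique as → Unique bs → Unique cs → Unique (grid as bs cs)
unique-grid {as = as} {bs} {cs} uas ubs ucs = unique-concatMap _ proj₁ as first-key
  (λ a → unique-concatMap _ (proj₁ ∘ proj₂) bs (second-key a)
    (λ b → unique-map _ cs (λ c c′ _ _ e → cong (proj₂ ∘ proj₂) e) ucs) ubs) uas
  where
  second-key : ∀ a b z → z ∈ map (λ c → (a , b , c)) cs → proj₁ (proj₂ z) ≡ b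
  second-key a b z m with ∈-map⁻ (λ c → (a , b , c)) m
  ... | c , _ , refl = refl
  first-key : ∀ a z → z ∈ concatMap (λ b → map (λ c → (a , b , c)) cs) bs → proj₁ z ≡ a
  first-key a z m with find (∈-concatMap⁻ (λ b → map (λ c → (a , b , c)) cs) {xs = bs} m)
  ... | b , _ , m′ with ∈-map⁻ (λ c → (a , b , c)) m′
  ... | c , _ , refl = refl

Σ-grid : ∀ {A B C : Set} (f : A × B × C → ℚ) as bs cs →
         Σ f (grid as bs cs) ≡ Σ (λ a → Σ (λ b → Σ (λ c → f (a , b , c)) cs) bs) as
Σ-grid f as bs cs = trans (Σ-concatMap f (λ a → concatMap (λ b → map (λ c → (a , b , c)) cs) bs) as)
  (Σ-cong as (λ a _ → trans (Σ-concatMap f (λ b → map (λ c → (a , b , c)) cs) bs)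
    (Σ-cong bs (λ b _ → Σ-map f (λ c → (a , b , c)) cs))))

Σ³ : List Pt → (Pt → Pt → Pt → ℚ) → ℚ
Σ³ V f = Σ (λ u → Σ (λ x → Σ (λ y → f u x y) V) V) V

Σ³-mono : ∀ V {f g} → (∀ {u x y} → u ∈ V → x ∈ V → y ∈ V → f u x y ℚ.≤ g u x y) → Σ³ V f ℚ.≤ Σ³ V g
Σ³-mono V h = Σ-mono V (λ u u∈ → Σ-mono V (λ x x∈ → Σ-mono V (λ y y∈ → h u∈ x∈ y∈)))

Σ³-rotate : ∀ V f → Σ³ V (λ u x y → f x y u) ≡ Σ³ V f
Σ³-rotate V f = trans (Σ-swap (λ u x → Σ (λ y → f x y u) V) V V)
                      (Σ-cong V (λ x _ → Σ-swap (λ u y → f x y u) V V))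

Σ³-+ : ∀ V f g → Σ³ V (λ u x y → f u x y ℚ.+ g u x y) ≡ Σ³ V f ℚ.+ Σ³ V g
Σ³-+ V f g = trans (Σ-cong V (λ u _ → trans (Σ-cong V (λ x _ → Σ-+ (f u x) (g u x) V)) (Σ-+ _ _ V))) (Σ-+ _ _ V)

Σ³-*ʳ : ∀ V f c → Σ³ V f ℚ.* c ≡ Σ³ V (λ u x y → f u x y ℚ.* c)
Σ³-*ʳ V f c = trans (Σ-*ʳ c _ V) (Σ-cong V (λ u _ → trans (Σ-*ʳ c _ V) (Σ-cong V (λ x _ → Σ-*ʳ c (f u x) V))))

Σ³-path : ∀ V (K₁ K₂ W : Pt → Pt → ℚ) c₁ c₂ w →
  (∀ {s t} → s ∈ V → t ∈ V → 0ℚ ℚ.≤ K₁ s t) → (∀ {s t} → s ∈ V → t ∈ V → 0ℚ ℚ.≤ K₂ s t) →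
  (∀ {s} → s ∈ V → Σ (K₁ s) V ℚ.≤ c₁) → (∀ {s} → s ∈ V → Σ (K₂ s) V ℚ.≤ c₂) →
  (∀ {s t} → s ∈ V → t ∈ V → W s t ℚ.≤ w) → 0ℚ ℚ.≤ c₂ → 0ℚ ℚ.≤ w →
  Σ³ V (λ u x y → K₁ u x ℚ.* K₂ x y ℚ.* W y u) ℚ.≤ ι (length V) ℚ.* (c₁ ℚ.* (c₂ ℚ.* w))
Σ³-path V K₁ K₂ W c₁ c₂ w K₁≥0 K₂≥0 row₁ row₂ W≤w c₂≥0 w≥0 = begin
  Σ³ V (λ u x y → K₁ u x ℚ.* K₂ x y ℚ.* W y u)
    ≤⟨ Σ³-mono V (λ u∈ x∈ y∈ → *-monoˡ _ (*-nonneg (K₁≥0 u∈ x∈) (K₂≥0 x∈ y∈)) (W≤w y∈ u∈)) ⟩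
  Σ³ V (λ u x y → K₁ u x ℚ.* K₂ x y ℚ.* w)
    ≤⟨ Σ-mono V (λ u u∈ → row u u∈) ⟩
  Σ (λ _ → c₁ ℚ.* (c₂ ℚ.* w)) V
    ≡⟨ Σ-const _ V ⟩
  ι (length V) ℚ.* (c₁ ℚ.* (c₂ ℚ.* w)) ∎
  where
  open ℚP.≤-Reasoning
  row : ∀ u → u ∈ V → Σ (λ x → Σ (λ y → K₁ u x ℚ.* K₂ x y ℚ.* w) V) V ℚ.≤ c₁ ℚ.* (c₂ ℚ.* w)
  row u u∈ = begin
    Σ (λ x → Σ (λ y → K₁ u x ℚ.* K₂ x y ℚ.* w) V) V
      ≡⟨ Σ-cong V (λ x _ → trans (Σ-cong V (λ y _ → ℚP.*-assoc (K₁ u x) (K₂ x y) w))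
                         (trans (sym (Σ-*ˡ (K₁ u x) (λ y → K₂ x y ℚ.* w) V))
                         (cong (K₁ u x ℚ.*_) (sym (Σ-*ʳ w (K₂ x) V))))) ⟩
    Σ (λ x → K₁ u x ℚ.* (Σ (K₂ x) V ℚ.* w)) V
      ≤⟨ Σ-mono V (λ x x∈ → *-monoˡ (K₁ u x) (K₁≥0 u∈ x∈) (*-monoʳ w w≥0 (row₂ x∈))) ⟩
    Σ (λ x → K₁ u x ℚ.* (c₂ ℚ.* w)) V
      ≡⟨ sym (Σ-*ʳ (c₂ ℚ.* w) (K₁ u) V) ⟩
    Σ (K₁ u) V ℚ.* (c₂ ℚ.* w)
      ≤⟨ *-monoʳ (c₂ ℚ.* w) (*-nonneg c₂≥0 w≥0) (row₁ u∈) ⟩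
    c₁ ℚ.* (c₂ ℚ.* w) ∎

∧-proj₁ : ∀ {x y} → T (x ∧ y) → T x
∧-proj₁ h = proj₁ (Equivalence.to T-∧ h)

∧-proj₂ : ∀ {x y} → T (x ∧ y) → T y
∧-proj₂ h = proj₂ (Equivalence.to T-∧ h)

∧-intro : ∀ {x y} → T x → T y → T (x ∧ y)
∧-intro a b = Equivalence.from T-∧ (a , b)

eqPt-sound : ∀ p q → T (eqPt p q) → p ≡ q
eqPt-sound (a , b , c) (a′ , b′ , c′) h
  with refl ← toWitness (∧-proj₁ {eqZ a a′} h)
     | refl ← toWitness (∧-proj₁ {eqZ b b′} (∧-proj₂ {eqZ a a′} h))
     | refl ← toWitness (∧-proj₂ {eqZ b b′} (∧-proj₂ {eqZ a a′} h)) = refl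

eqPt-true : ∀ {p q} → eqPt p q ≡ true → p ≡ q
eqPt-true {p} {q} e = eqPt-sound p q (subst T (sym e) _)

eqPt-refl : ∀ p → eqPt p p ≡ true
eqPt-refl (a , b , c) = Equivalence.to T-≡
  (∧-intro (fromWitness {a? = a ℤ.≟ a} refl)
    (∧-intro (fromWitness {a? = b ℤ.≟ b} refl) (fromWitness {a? = c ℤ.≟ c} refl)))

eqPt-false : ∀ {p q} → eqPt p q ≡ false → ¬ p ≡ q
eqPt-false {p} e refl with () ← trans (sym (eqPt-refl p)) e

≢⇒eqPt-false : ∀ p q → ¬ p ≡ q → eqPt p q ≡ false
≢⇒eqPt-false p q p≢q with eqPt p q in e
... | false = refl
... | true = ⊥-elim (p≢q (eqPt-true e))

T-not-eqPt : ∀ {p q} → T (not (eqPt p q)) → ¬ p ≡ q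
T-not-eqPt {p} t refl = subst (T ∘ not) (eqPt-refl p) t

module _ where
  open ℤSolver

  minus-plus : ∀ x a → (x ℤ.- a) ℤ.+ a ≡ x
  minus-plus = solve 2 (λ x a → (x :- a) :+ a := x) refl

  minus-shift : ∀ x e → x ℤ.- (e ℤ.+ x) ≡ ℤ.- e
  minus-shift = solve 2 (λ x e → x :- (e :+ x) := :- e) refl

  minus-unshift : ∀ x e → x ℤ.- (ℤ.- e ℤ.+ x) ≡ e
  minus-unshift = solve 2 (λ x e → x :- (:- e :+ x) := e) refl

  shift-forth : ∀ x n → (x ℤ.+ + n) ℤ.- + n ≡ x
  shift-forth x n = solve 2 (λ x m → (x :+ m) :- m := x) refl x (+ n)

unique-rangeZ : ∀ n → Unique (rangeZ n)
unique-rangeZ n = unique-map (λ i → + i ℤ.- + n) (upTo (suc (n ℕ.+ n)))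
  (λ i j _ _ e → ℤP.+-injective (trans (sym (minus-plus (+ i) (+ n)))
                   (trans (cong (ℤ._+ + n) e) (minus-plus (+ j) (+ n)))))
  (Unique.upTo⁺ _)

∈-rangeZ : ∀ n x → ∣ x ∣ ≤ n → x ∈ rangeZ n
∈-rangeZ n (+ m) h = subst (_∈ rangeZ n) (trans (cong (ℤ._- + n) (ℤP.pos-+ m n)) (shift-forth (+ m) n))
  (∈-map⁺ (λ i → + i ℤ.- + n) (∈-upTo⁺ (s≤s (ℕP.+-monoˡ-≤ n h))))
∈-rangeZ n -[1+ m ] h = subst (_∈ rangeZ n) (trans (cong (ℤ._- + n) (sym (ℤP.⊖-≥ h))) (shift-forth -[1+ m ] n))
  (∈-map⁺ (λ i → + i ℤ.- + n) (∈-upTo⁺ (s≤s (ℕP.≤-trans (ℕP.m∸n≤m n (suc m)) (ℕP.m≤m+n n n)))))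

unique-Vs : ∀ n → Unique (Vs n)
unique-Vs n = unique-filterᵇ (inV n) {xs = grid (rangeZ n) (rangeZ n) (rangeZ n)} 
  (unique-grid (unique-rangeZ n) (unique-rangeZ n) (unique-rangeZ n))

Vs-sound : ∀ {n p} → p ∈ Vs n → norm1 p ≡ n
Vs-sound {n} {p} m = ℕP.≡ᵇ⇒≡ (norm1 p) n (proj₂ (∈-filterᵇ⁻ (inV n) {xs = grid (rangeZ n) (rangeZ n) (rangeZ n)} m))

coordinates-in-range : ∀ {n a b c} → norm1 (a , b , c) ≡ n → a ∈ rangeZ n × b ∈ rangeZ n × c ∈ rangeZ n
coordinates-in-range {n} {a} {b} {c} h =
  ∈-rangeZ n a (subst (∣ a ∣ ≤_) h (ℕP.≤-trans (ℕP.m≤m+n ∣ a ∣ ∣ b ∣) (ℕP.m≤m+n _ ∣ c ∣))) ,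
  ∈-rangeZ n b (subst (∣ b ∣ ≤_) h (ℕP.≤-trans (ℕP.m≤n+m ∣ b ∣ ∣ a ∣) (ℕP.m≤m+n _ ∣ c ∣))) ,
  ∈-rangeZ n c (subst (∣ c ∣ ≤_) h (ℕP.m≤n+m ∣ c ∣ (∣ a ∣ ℕ.+ ∣ b ∣)))

Vs-complete : ∀ {n p} → norm1 p ≡ n → p ∈ Vs n
Vs-complete {n} {a , b , c} h with coordinates-in-range h
... | ma , mb , mc = ∈-filterᵇ⁺ (inV n) (∈-grid ma mb mc) (ℕP.≡⇒≡ᵇ _ n h)

unique-others : ∀ n u → Unique (others n u)
unique-others n u = unique-filterᵇ (λ v → not (eqPt u v)) {xs = Vs n} (unique-Vs n)

∈-others : ∀ {n s t} → t ∈ Vs n → ¬ s ≡ t → t ∈ others n s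
∈-others {n} {s} {t} m s≢t =
  ∈-filterᵇ⁺ (λ v → not (eqPt s v)) m (subst (T ∘ not) (sym (≢⇒eqPt-false s t s≢t)) _)

Σ-assigns : ∀ us (f : Pt → List Pt) (h : Pt × Pt → ℚ) →
            Σ (Π h) (assigns us f) ≡ Π (λ u → Σ (λ v → h (u , v)) (f u)) us
Σ-assigns [] f h = ℚP.+-identityʳ 1ℚ
Σ-assigns (u ∷ us) f h = begin
  Σ (Π h) (concatMap (λ v → map ((u , v) ∷_) (assigns us f)) (f u))
    ≡⟨ Σ-concatMap (Π h) (λ v → map ((u , v) ∷_) (assigns us f)) (f u) ⟩
  Σ (λ v → Σ (Π h) (map ((u , v) ∷_) (assigns us f))) (f u)
    ≡⟨ Σ-cong (f u) (λ v _ → trans (Σ-map (Π h) ((u , v) ∷_) (assigns us f))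
                                  (sym (Σ-*ˡ (h (u , v)) (Π h) (assigns us f)))) ⟩
  Σ (λ v → h (u , v) ℚ.* Σ (Π h) (assigns us f)) (f u)
    ≡⟨ sym (Σ-*ʳ _ (λ v → h (u , v)) (f u)) ⟩
  Σ (λ v → h (u , v)) (f u) ℚ.* Σ (Π h) (assigns us f)
    ≡⟨ cong (Σ (λ v → h (u , v)) (f u) ℚ.*_) (Σ-assigns us f h) ⟩
  Σ (λ v → h (u , v)) (f u) ℚ.* Π (λ u → Σ (λ v → h (u , v)) (f u)) us ∎
  where open ≡-Reasoning

assigns-sources : ∀ us (f : Pt → List Pt) {a} → a ∈ assigns us f → map proj₁ a ≡ us
assigns-sources [] f (here refl) = refl
assigns-sources (u ∷ us) f m with find (∈-concatMap⁻ (λ v → map ((u , v) ∷_) (assigns us f)) {xs = f u} m)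
... | v , _ , m′ with ∈-map⁻ ((u , v) ∷_) m′
... | a′ , m″ , refl = cong (u ∷_) (assigns-sources us f m″)

chosen : Assign → Pt → Pt → Bool
chosen a s t = any (λ { (u , v) → eqPt u s ∧ eqPt v t }) a

-- The event "(s , t) ∈ E" only depends on the choice of s; arcFactor s t is
-- the factor of a product over the outcome that dominates its indicator.
arcFactor : Pt → Pt → Pt × Pt → ℚ
arcFactor s t (s′ , v) = if eqPt s′ s then ind (adj'B s t ∨ eqPt v t) else 1ℚ

Π-away : ∀ {A : Set} (key : A → Pt) c (g : A → ℚ) xs → (∀ x → x ∈ xs → ¬ key x ≡ c) →
         Π (λ x → if eqPt (key x) c then g x else 1ℚ) xs ≡ 1ℚ
Π-away key c g [] _ = refl
Π-away key c g (x ∷ xs) away with eqPt (key x) c in e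
... | true = ⊥-elim (away x (here refl) (eqPt-true e))
... | false = trans (ℚP.*-identityˡ _) (Π-away key c g xs (λ y m → away y (there m)))

chosen-absent : ∀ {s} t a → s ∉ map proj₁ a → chosen a s t ≡ false
chosen-absent t [] _ = refl
chosen-absent {s} t ((s′ , v) ∷ a) s∉ with eqPt s′ s in e
... | true = ⊥-elim (s∉ (here (sym (eqPt-true e))))
... | false = chosen-absent t a (s∉ ∘ there)

arcFactor-absent : ∀ {s} t a → s ∉ map proj₁ a → Π (arcFactor s t) a ≡ 1ℚ
arcFactor-absent {s} t a s∉ =
  Π-away proj₁ s (λ e → ind (adj'B s t ∨ eqPt (proj₂ e) t)) a
    (λ e m e≡ → s∉ (subst (_∈ map proj₁ a) e≡ (∈-map⁺ proj₁ m)))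

-- Up to the product bound, the arc (s , t) is present when it is in E' or
-- when s chose t; this uses that each source chooses only once.
arc-≤-Π : ∀ s t a → Unique (map proj₁ a) → ind (arcB a s t) ℚ.≤ Π (arcFactor s t) a
arc-≤-Π s t [] _ = ind-≤1 (adj'B s t ∨ false)
arc-≤-Π s t ((s′ , v) ∷ a) (s′∉ ∷ unique) with eqPt s′ s in e
... | true = ≤-reflexive (begin
  ind (adj'B s t ∨ (eqPt v t ∨ chosen a s t))
    ≡⟨ cong (λ c → ind (adj'B s t ∨ (eqPt v t ∨ c))) (chosen-absent t a s∉) ⟩
  ind (adj'B s t ∨ (eqPt v t ∨ false))
    ≡⟨ cong (λ c → ind (adj'B s t ∨ c)) (∨-identityʳ (eqPt v t)) ⟩
  ind (adj'B s t ∨ eqPt v t)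
    ≡⟨ sym (ℚP.*-identityʳ _) ⟩
  ind (adj'B s t ∨ eqPt v t) ℚ.* 1ℚ
    ≡⟨ cong (ind (adj'B s t ∨ eqPt v t) ℚ.*_) (sym (arcFactor-absent t a s∉)) ⟩
  ind (adj'B s t ∨ eqPt v t) ℚ.* Π (arcFactor s t) a ∎)
  where
  open ≡-Reasoning
  s∉ : s ∉ map proj₁ a
  s∉ m = All.lookup s′∉ m (eqPt-true e)
... | false = ≤-trans (arc-≤-Π s t a unique) (≤-reflexive (sym (ℚP.*-identityˡ _)))

at : Pt → ℚ → Pt → ℚ
at c β s = if eqPt s c then β else 1ℚ

Π-at : ∀ c β V → Unique V → c ∈ V → Π (at c β) V ≡ β
Π-at c β (s ∷ V) (s∉V ∷ unique) c∈ with eqPt s c in e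
... | true = trans (cong (β ℚ.*_) (Π-away (λ x → x) c (λ _ → β) V c∉V)) (ℚP.*-identityʳ β)
  where
  c∉V : ∀ x → x ∈ V → ¬ x ≡ c
  c∉V x m x≡c = All.lookup s∉V m (trans (eqPt-true e) (sym x≡c))
... | false with c∈
...   | here c≡s = ⊥-elim (eqPt-false e (sym c≡s))
...   | there c∈V = trans (ℚP.*-identityˡ _) (Π-at c β V unique c∈V)

arcFactor-nonneg : ∀ s t e → 0ℚ ℚ.≤ arcFactor s t e
arcFactor-nonneg s t (s′ , v) with eqPt s′ s
... | true = ind-nonneg (adj'B s t ∨ eqPt v t)
... | false = frac-nonneg 1 0

cycleFactor : Pt → Pt → Pt → Pt × Pt → ℚ
cycleFactor u x y e = arcFactor u x e ℚ.* arcFactor x y e ℚ.* arcFactor y u e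

cycleFactor-nonneg : ∀ u x y e → 0ℚ ℚ.≤ cycleFactor u x y e
cycleFactor-nonneg u x y e =
  *-nonneg (*-nonneg (arcFactor-nonneg u x e) (arcFactor-nonneg x y e)) (arcFactor-nonneg y u e)

arcs-≤-Π : ∀ u x y L a → Unique (map proj₁ a) →
  ind (arcB a u x ∧ (arcB a x y ∧ (arcB a y u ∧ L)))
    ℚ.≤ Π (cycleFactor u x y) a ℚ.* ind L
arcs-≤-Π u x y L a unique = begin
  ind (arcB a u x ∧ (arcB a x y ∧ (arcB a y u ∧ L)))
    ≡⟨ trans (ind-∧ (arcB a u x) _) (cong (ind (arcB a u x) ℚ.*_)
         (trans (ind-∧ (arcB a x y) _) (cong (ind (arcB a x y) ℚ.*_) (ind-∧ (arcB a y u) L)))) ⟩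
  ind (arcB a u x) ℚ.* (ind (arcB a x y) ℚ.* (ind (arcB a y u) ℚ.* ind L))
    ≤⟨ *-mono (ind-nonneg (arcB a u x))
         (*-nonneg (ind-nonneg (arcB a x y)) (*-nonneg (ind-nonneg (arcB a y u)) (ind-nonneg L)))
         (arc-≤-Π u x a unique)
         (*-mono (ind-nonneg (arcB a x y)) (*-nonneg (ind-nonneg (arcB a y u)) (ind-nonneg L))
           (arc-≤-Π x y a unique) (*-monoʳ (ind L) (ind-nonneg L) (arc-≤-Π y u a unique))) ⟩
  P₁ ℚ.* (P₂ ℚ.* (P₃ ℚ.* ind L))
    ≡⟨ reassociate P₁ P₂ P₃ (ind L) ⟩
  P₁ ℚ.* P₂ ℚ.* P₃ ℚ.* ind L
    ≡⟨ cong (ℚ._* ind L) (sym (trans (Π-* _ _ a) (cong (ℚ._* P₃) (Π-* _ _ a)))) ⟩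
  Π (cycleFactor u x y) a ℚ.* ind L ∎
  where
  open ℚP.≤-Reasoning
  P₁ = Π (arcFactor u x) a
  P₂ = Π (arcFactor x y) a
  P₃ = Π (arcFactor y u) a
  open +-*-Solver
  reassociate : ∀ a b c l → a ℚ.* (b ℚ.* (c ℚ.* l)) ≡ a ℚ.* b ℚ.* c ℚ.* l
  reassociate = solve 4 (λ a b c l → a :* (b :* (c :* l)) := a :* b :* c :* l) refl

module _ (n : ℕ) (d : Pt → Pt → ℕ) where

  mass : Pt → ℚ
  mass s = Σ (λ w → invSq (d s w)) (others n s)

  Z-nonneg : ∀ s → 0ℚ ℚ.≤ Zc n d s
  Z-nonneg s = recip-nonneg (mass s) (Σ-nonneg (others n s) (λ w _ → invSq-nonneg (d s w)))

  prob-nonneg : ∀ s t → 0ℚ ℚ.≤ prob n d s t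
  prob-nonneg s t = *-nonneg (Z-nonneg s) (invSq-nonneg (d s t))

  prob-≤-Z : ∀ s t → prob n d s t ℚ.≤ Zc n d s
  prob-≤-Z s t = ≤-trans (*-monoˡ (Zc n d s) (Z-nonneg s) (invSq-≤1 (d s t))) (≤-reflexive (ℚP.*-identityʳ _))

  -- The long-range arc of s is a probability distribution on V ∖ {s} (of mass
  -- at most 1, which is all that is used).
  row-total : ∀ s → Σ (prob n d s) (others n s) ℚ.≤ 1ℚ
  row-total s = subst (ℚ._≤ 1ℚ) (Σ-*ˡ (Zc n d s) (λ w → invSq (d s w)) (others n s)) (recip-* (mass s))

  row-single : ∀ s t → Σ (λ v → prob n d s v ℚ.* ind (eqPt v t)) (others n s) ℚ.≤ prob n d s t
  row-single s t = begin
    Σ (λ v → prob n d s v ℚ.* ind (eqPt v t)) (others n s)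
      ≡⟨ Σ-cong (others n s) (λ v _ → ℚP.*-comm (prob n d s v) _) ⟩
    Σ (λ v → ind (eqPt v t) ℚ.* prob n d s v) (others n s)
      ≡⟨ Σ-filterᵇ (λ v → eqPt v t) (prob n d s) (others n s) ⟩
    Σ (prob n d s) (filterᵇ (λ v → eqPt v t) (others n s))
      ≤⟨ Σ-sublist (prob n d s) _ (t ∷ []) (unique-filterᵇ (λ v → eqPt v t) (unique-others n s))
           (λ v m → here (eqPt-sound v t (proj₂ (∈-filterᵇ⁻ (λ v → eqPt v t) {xs = others n s} m))))
           (λ v _ → prob-nonneg s v) ⟩
    prob n d s t ℚ.+ 0ℚ
      ≡⟨ ℚP.+-identityʳ _ ⟩
    prob n d s t ∎
    where open ℚP.≤-Reasoning

  𝔼 : (Assign → ℚ) → ℚ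
  𝔼 F = Σ (λ a → weight n d a ℚ.* F a) (outcomes n)

  weight-nonneg : ∀ a → 0ℚ ℚ.≤ weight n d a
  weight-nonneg a = Π-nonneg a (λ e _ → prob-nonneg (proj₁ e) (proj₂ e))

  𝔼-mono : ∀ {F G} → (∀ a → a ∈ outcomes n → F a ℚ.≤ G a) → 𝔼 F ℚ.≤ 𝔼 G
  𝔼-mono h = Σ-mono (outcomes n) (λ a m → *-monoˡ (weight n d a) (weight-nonneg a) (h a m))

  𝔼-scale : ∀ c F → 𝔼 (λ a → F a ℚ.* c) ≡ 𝔼 F ℚ.* c
  𝔼-scale c F = trans (Σ-cong (outcomes n) (λ a _ → sym (ℚP.*-assoc (weight n d a) (F a) c)))
                      (sym (Σ-*ʳ c _ (outcomes n)))

  𝔼-zero : 𝔼 (λ _ → 0ℚ) ≡ 0ℚ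
  𝔼-zero = trans (Σ-cong (outcomes n) (λ a _ → ℚP.*-zeroʳ (weight n d a))) (Σ-zero (outcomes n))

  𝔼-Σ : ∀ {A : Set} (F : A → Assign → ℚ) xs → 𝔼 (λ a → Σ (λ x → F x a) xs) ≡ Σ (λ x → 𝔼 (F x)) xs
  𝔼-Σ F xs = trans (Σ-cong (outcomes n) (λ a _ → Σ-*ˡ (weight n d a) (λ x → F x a) xs))
                   (Σ-swap (λ a x → weight n d a ℚ.* F x a) (outcomes n) xs)

  𝔼-product : ∀ (g : Pt × Pt → ℚ) →
    𝔼 (Π g) ≡ Π (λ s → Σ (λ v → prob n d s v ℚ.* g (s , v)) (others n s)) (Vs n)
  𝔼-product g = trans (Σ-cong (outcomes n) (λ a _ → sym (Π-* (λ e → prob n d (proj₁ e) (proj₂ e)) g a)))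
                      (Σ-assigns (Vs n) (others n) (λ e → prob n d (proj₁ e) (proj₂ e) ℚ.* g e))

  unique-sources : ∀ {a} → a ∈ outcomes n → Unique (map proj₁ a)
  unique-sources m = subst Unique (sym (assigns-sources (Vs n) (others n) m)) (unique-Vs n)

  arcBound : Pt → Pt → ℚ
  arcBound s t = ind (adj'B s t) ℚ.+ prob n d s t

  arcBound-nonneg : ∀ s t → 0ℚ ℚ.≤ arcBound s t
  arcBound-nonneg s t = +-nonneg (ind-nonneg (adj'B s t)) (prob-nonneg s t)

  arcFactor-mean : ∀ s t → Σ (λ v → prob n d s v ℚ.* ind (adj'B s t ∨ eqPt v t)) (others n s) ℚ.≤ arcBound s t
  arcFactor-mean s t with adj'B s t
  ... | true = begin
    Σ (λ v → prob n d s v ℚ.* 1ℚ) (others n s) ≡⟨ Σ-cong (others n s) (λ v _ → ℚP.*-identityʳ _) ⟩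
    Σ (prob n d s) (others n s)                 ≤⟨ row-total s ⟩
    1ℚ                                          ≤⟨ ≤-trans (≤-reflexive (sym (ℚP.+-identityʳ 1ℚ)))
                                                     (+-mono-≤ ≤-refl (prob-nonneg s t)) ⟩
    1ℚ ℚ.+ prob n d s t ∎
    where open ℚP.≤-Reasoning
  ... | false = ≤-trans (row-single s t) (≤-reflexive (sym (ℚP.+-identityˡ _)))

  Σ-prob-cong : ∀ s {f g : Pt → ℚ} → (∀ v → f v ≡ g v) →
    Σ (λ v → prob n d s v ℚ.* f v) (others n s) ≡ Σ (λ v → prob n d s v ℚ.* g v) (others n s)
  Σ-prob-cong s h = Σ-cong (others n s) (λ v _ → cong (prob n d s v ℚ.*_) (h v))

  -- For distinct u, x, y the choice of each source s affects at most one of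
  -- the three arcs, so its factor has mean at most the corresponding arcBound.
  source-bound : ∀ {u x y} → ¬ u ≡ x → ¬ x ≡ y → ¬ y ≡ u → ∀ s →
    Σ (λ v → prob n d s v ℚ.* cycleFactor u x y (s , v)) (others n s)
      ℚ.≤ at u (arcBound u x) s ℚ.* at x (arcBound x y) s ℚ.* at y (arcBound y u) s
  source-bound {u} {x} {y} u≢x x≢y y≢u s with eqPt s u in e₁ | eqPt s x in e₂ | eqPt s y in e₃
  ... | true | true | _ = ⊥-elim (u≢x (trans (sym (eqPt-true {s} e₁)) (eqPt-true {s} e₂)))
  ... | true | false | true = ⊥-elim (y≢u (trans (sym (eqPt-true {s} e₃)) (eqPt-true {s} e₁)))
  ... | false | true | true = ⊥-elim (x≢y (trans (sym (eqPt-true {s} e₂)) (eqPt-true {s} e₃)))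
  ... | true | false | false with refl ← eqPt-true {s} {u} e₁ =
    ≤-trans (≤-reflexive (Σ-prob-cong s (λ v → trans (ℚP.*-identityʳ _) (ℚP.*-identityʳ _))))
      (≤-trans (arcFactor-mean s x) (≤-reflexive (sym (trans (ℚP.*-identityʳ _) (ℚP.*-identityʳ _)))))
  ... | false | true | false with refl ← eqPt-true {s} {x} e₂ =
    ≤-trans (≤-reflexive (Σ-prob-cong s (λ v → trans (ℚP.*-identityʳ _) (ℚP.*-identityˡ _))))
      (≤-trans (arcFactor-mean s y) (≤-reflexive (sym (trans (ℚP.*-identityʳ _) (ℚP.*-identityˡ _)))))
  ... | false | false | true with refl ← eqPt-true {s} {y} e₃ =
    ≤-trans (≤-reflexive (Σ-prob-cong s (λ v → ℚP.*-identityˡ _)))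
      (≤-trans (arcFactor-mean s u) (≤-reflexive (sym (ℚP.*-identityˡ _))))
  ... | false | false | false =
    ≤-trans (≤-reflexive (Σ-cong (others n s) (λ v _ → ℚP.*-identityʳ (prob n d s v)))) (row-total s)

  arcs-mean : ∀ {u x y} → u ∈ Vs n → x ∈ Vs n → y ∈ Vs n → ¬ u ≡ x → ¬ x ≡ y → ¬ y ≡ u →
    𝔼 (Π (cycleFactor u x y)) ℚ.≤ arcBound u x ℚ.* arcBound x y ℚ.* arcBound y u
  arcs-mean {u} {x} {y} u∈ x∈ y∈ u≢x x≢y y≢u = begin
    𝔼 (Π (cycleFactor u x y))
      ≡⟨ 𝔼-product (cycleFactor u x y) ⟩
    Π (λ s → Σ (λ v → prob n d s v ℚ.* cycleFactor u x y (s , v)) (others n s)) (Vs n)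
      ≤⟨ Π-mono (Vs n)
           (λ s _ → Σ-nonneg (others n s) (λ v _ → *-nonneg (prob-nonneg s v) (cycleFactor-nonneg u x y (s , v))))
           (λ s _ → source-bound u≢x x≢y y≢u s) ⟩
    Π (λ s → at u K₁ s ℚ.* at x K₂ s ℚ.* at y K₃ s) (Vs n)
      ≡⟨ trans (Π-* _ (at y K₃) (Vs n)) (cong (ℚ._* Π (at y K₃) (Vs n)) (Π-* (at u K₁) (at x K₂) (Vs n))) ⟩
    Π (at u K₁) (Vs n) ℚ.* Π (at x K₂) (Vs n) ℚ.* Π (at y K₃) (Vs n)
      ≡⟨ cong₂ ℚ._*_ (cong₂ ℚ._*_ (Π-at u K₁ (Vs n) (unique-Vs n) u∈) (Π-at x K₂ (Vs n) (unique-Vs n) x∈))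
                     (Π-at y K₃ (Vs n) (unique-Vs n) y∈) ⟩
    K₁ ℚ.* K₂ ℚ.* K₃ ∎
    where
    open ℚP.≤-Reasoning
    K₁ = arcBound u x
    K₂ = arcBound x y
    K₃ = arcBound y u

  closing : Pt → Pt → Pt → ℚ
  closing u x y = arcBound u x ℚ.* arcBound x y ℚ.* prob n d y u

  -- One term for each choice of the long-range arc, written as a rotation of closing.
  cycleBound : Pt → Pt → Pt → ℚ
  cycleBound u x y = closing x y u ℚ.+ closing y u x ℚ.+ closing u x y

  closing-nonneg : ∀ u x y → 0ℚ ℚ.≤ closing u x y
  closing-nonneg u x y = *-nonneg (*-nonneg (arcBound-nonneg u x) (arcBound-nonneg x y)) (prob-nonneg y u)

  cycleBound-nonneg : ∀ u x y → 0ℚ ℚ.≤ cycleBound u x y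
  cycleBound-nonneg u x y =
    +-nonneg (+-nonneg (closing-nonneg x y u) (closing-nonneg y u x)) (closing-nonneg u x y)

  -- A long-range arc is not an arc of G'_n, so only its probability remains.
  long-arc : ∀ s t → ind (longB s t) ℚ.* arcBound s t ℚ.≤ prob n d s t
  long-arc s t with adj'B s t
  ... | true = ≤-trans (≤-reflexive (ℚP.*-zeroˡ (1ℚ ℚ.+ prob n d s t))) (prob-nonneg s t)
  ... | false = ≤-reflexive (trans (ℚP.*-identityˡ _) (ℚP.+-identityˡ _))

  long-arcs : ∀ u x y →
    arcBound u x ℚ.* arcBound x y ℚ.* arcBound y u ℚ.* ind (longB u x ∨ longB x y ∨ longB y u)
      ℚ.≤ cycleBound u x y
  long-arcs u x y = begin
    K₁ ℚ.* K₂ ℚ.* K₃ ℚ.* ind (l₁ ∨ l₂ ∨ l₃)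
      ≤⟨ *-monoˡ (K₁ ℚ.* K₂ ℚ.* K₃) (*-nonneg (*-nonneg (arcBound-nonneg u x) (arcBound-nonneg x y)) (arcBound-nonneg y u))
           (≤-trans (ind-∨ l₁ (l₂ ∨ l₃)) (+-mono-≤ (≤-refl {ind l₁}) (ind-∨ l₂ l₃))) ⟩
    K₁ ℚ.* K₂ ℚ.* K₃ ℚ.* (ind l₁ ℚ.+ (ind l₂ ℚ.+ ind l₃))
      ≡⟨ distribute K₁ K₂ K₃ (ind l₁) (ind l₂) (ind l₃) ⟩
    K₂ ℚ.* K₃ ℚ.* (ind l₁ ℚ.* K₁) ℚ.+ K₃ ℚ.* K₁ ℚ.* (ind l₂ ℚ.* K₂) ℚ.+ K₁ ℚ.* K₂ ℚ.* (ind l₃ ℚ.* K₃)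
      ≤⟨ +-mono-≤ (+-mono-≤ (*-monoˡ (K₂ ℚ.* K₃) (*-nonneg (arcBound-nonneg x y) (arcBound-nonneg y u)) (long-arc u x))
                            (*-monoˡ (K₃ ℚ.* K₁) (*-nonneg (arcBound-nonneg y u) (arcBound-nonneg u x)) (long-arc x y)))
                  (*-monoˡ (K₁ ℚ.* K₂) (*-nonneg (arcBound-nonneg u x) (arcBound-nonneg x y)) (long-arc y u)) ⟩
    cycleBound u x y ∎
    where
    open ℚP.≤-Reasoning
    K₁ = arcBound u x
    K₂ = arcBound x y
    K₃ = arcBound y u
    l₁ = longB u x
    l₂ = longB x y
    l₃ = longB y u
    open +-*-Solver
    distribute : ∀ a b c i j k → a ℚ.* b ℚ.* c ℚ.* (i ℚ.+ (j ℚ.+ k)) ≡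
                 b ℚ.* c ℚ.* (i ℚ.* a) ℚ.+ c ℚ.* a ℚ.* (j ℚ.* b) ℚ.+ a ℚ.* b ℚ.* (k ℚ.* c)
    distribute = solve 6 (λ a b c i j k → a :* b :* c :* (i :+ (j :+ k)) :=
                                          b :* c :* (i :* a) :+ c :* a :* (j :* b) :+ a :* b :* (k :* c)) refl

  𝔼-guard : ∀ b (F : Assign → Bool) {z} → 0ℚ ℚ.≤ z → (T b → 𝔼 (λ a → ind (F a)) ℚ.≤ z) →
            𝔼 (λ a → ind (b ∧ F a)) ℚ.≤ z
  𝔼-guard true F _ h = h _
  𝔼-guard false F 0≤z _ = ≤-trans (≤-reflexive 𝔼-zero) 0≤z

  cycle-mean : ∀ {u x y} → u ∈ Vs n → x ∈ Vs n → y ∈ Vs n →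
               𝔼 (λ a → ind (cycleB a u x y)) ℚ.≤ cycleBound u x y
  cycle-mean {u} {x} {y} u∈ x∈ y∈ =
    𝔼-guard (not (eqPt u x)) _ (cycleBound-nonneg u x y) λ u≢x →
    𝔼-guard (not (eqPt x y)) _ (cycleBound-nonneg u x y) λ x≢y →
    𝔼-guard (not (eqPt y u)) _ (cycleBound-nonneg u x y) λ y≢u → begin
      𝔼 (λ a → ind (arcB a u x ∧ (arcB a x y ∧ (arcB a y u ∧ L))))
        ≤⟨ 𝔼-mono (λ a m → arcs-≤-Π u x y L a (unique-sources m)) ⟩
      𝔼 (λ a → Π (cycleFactor u x y) a ℚ.* ind L)
        ≡⟨ 𝔼-scale (ind L) (Π (cycleFactor u x y)) ⟩
      𝔼 (Π (cycleFactor u x y)) ℚ.* ind L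
        ≤⟨ *-monoʳ (ind L) (ind-nonneg L)
             (arcs-mean u∈ x∈ y∈ (T-not-eqPt u≢x) (T-not-eqPt x≢y) (T-not-eqPt y≢u)) ⟩
      arcBound u x ℚ.* arcBound x y ℚ.* arcBound y u ℚ.* ind L
        ≤⟨ long-arcs u x y ⟩
      cycleBound u x y ∎
    where
    open ℚP.≤-Reasoning
    L = longB u x ∨ longB x y ∨ longB y u

  EX-≤ : EX n d ℚ.≤ Σ³ (Vs n) cycleBound
  EX-≤ = begin
    𝔼 (Xval n)
      ≤⟨ 𝔼-mono (λ a _ → frac-≤ (countOrd n a) 2 (countOrd n a) 0 (ℕP.*-monoʳ-≤ (countOrd n a) (s≤s z≤n))) ⟩
    𝔼 (λ a → ι (countOrd n a))
      ≡⟨ Σ-cong (outcomes n) (λ a _ → cong (weight n d a ℚ.*_) (count-as-Σ (isCycle a) (triples (Vs n)))) ⟩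
    𝔼 (λ a → Σ (λ t → ind (isCycle a t)) (triples (Vs n)))
      ≡⟨ 𝔼-Σ (λ t a → ind (isCycle a t)) (triples (Vs n)) ⟩
    Σ (λ t → 𝔼 (λ a → ind (isCycle a t))) (triples (Vs n))
      ≡⟨ Σ-grid (λ t → 𝔼 (λ a → ind (isCycle a t))) (Vs n) (Vs n) (Vs n) ⟩
    Σ³ (Vs n) (λ u x y → 𝔼 (λ a → ind (cycleB a u x y)))
      ≤⟨ Σ³-mono (Vs n) cycle-mean ⟩
    Σ³ (Vs n) cycleBound ∎
    where
    open ℚP.≤-Reasoning
    isCycle : Assign → Pt × Pt × Pt → Bool
    isCycle a t = cycleB a (proj₁ t) (proj₁ (proj₂ t)) (proj₂ (proj₂ t))

difference : Pt → Pt → Pt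
difference (a , b , c) (a′ , b′ , c′) = (a ℤ.- a′ , b ℤ.- b′ , c ℤ.- c′)

difference-injective : ∀ s t t′ → difference t s ≡ difference t′ s → t ≡ t′
difference-injective (a , b , c) (x , y , z) (x′ , y′ , z′) e =
  cong₂ _,_ (cancel x x′ a (cong proj₁ e))
    (cong₂ _,_ (cancel y y′ b (cong (proj₁ ∘ proj₂) e)) (cancel z z′ c (cong (proj₂ ∘ proj₂) e)))
  where
  cancel : ∀ x x′ a → x ℤ.- a ≡ x′ ℤ.- a → x ≡ x′
  cancel x x′ a h = trans (sym (minus-plus x a)) (trans (cong (ℤ._+ a) h) (minus-plus x′ a))

-- G'_n-neighbours differ by a vector of {-1,0,1}³, of which there are 27.
neighbour-difference : ∀ s t → T (adj'B s t) → difference t s ∈ grid (rangeZ 1) (rangeZ 1) (rangeZ 1)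
neighbour-difference (a , b , c) (x , y , z) h =
  ∈-grid (∈-rangeZ 1 _ (close a x (∧-proj₁ {closeZ a x} h′)))
         (∈-rangeZ 1 _ (close b y (∧-proj₁ {closeZ b y} (∧-proj₂ {closeZ a x} h′))))
         (∈-rangeZ 1 _ (close c z (∧-proj₂ {closeZ b y} (∧-proj₂ {closeZ a x} h′))))
  where
  h′ = ∧-proj₂ {not (eqPt (a , b , c) (x , y , z))} h
  close : ∀ p q → T (closeZ p q) → ∣ q ℤ.- p ∣ ≤ 1
  close p q h = subst (_≤ 1) (ℤP.∣i-j∣≡∣j-i∣ p q) (ℕP.≤ᵇ⇒≤ _ 1 h)

adjacency-row : ∀ n s → Σ (λ t → ind (adj'B s t)) (Vs n) ℚ.≤ ι 27
adjacency-row n s = begin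
  Σ (λ t → ind (adj'B s t)) (Vs n)
    ≡⟨ sym (count-as-Σ (adj'B s) (Vs n)) ⟩
  ι (length (filterᵇ (adj'B s) (Vs n)))
    ≤⟨ length-injection (λ t → difference t s) _ (grid (rangeZ 1) (rangeZ 1) (rangeZ 1))
         (unique-filterᵇ (adj'B s) (unique-Vs n)) (λ t t′ _ _ → difference-injective s t t′)
         (λ t m → neighbour-difference s t (proj₂ (∈-filterᵇ⁻ (adj'B s) {xs = Vs n} m))) ⟩
  ι 27 ∎
  where open ℚP.≤-Reasoning

-- On V the long-range probabilities of a source sum to at most 1: d(s,s) = 0,
-- so the term t = s vanishes.
prob-row : ∀ n d → IsDistance n d → ∀ {s} → s ∈ Vs n → Σ (prob n d s) (Vs n) ℚ.≤ 1ℚ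
prob-row n d isDist {s} s∈ = begin
  Σ (prob n d s) (Vs n)
    ≡⟨ Σ-cong (Vs n) (λ t _ → only-others t) ⟩
  Σ (λ t → ind (not (eqPt s t)) ℚ.* prob n d s t) (Vs n)
    ≡⟨ Σ-filterᵇ (λ t → not (eqPt s t)) (prob n d s) (Vs n) ⟩
  Σ (prob n d s) (others n s)
    ≤⟨ row-total n d s ⟩
  1ℚ ∎
  where
  open ℚP.≤-Reasoning
  s∈V : T (inV n s)
  s∈V = ℕP.≡⇒≡ᵇ _ n (Vs-sound s∈)
  d-self : d s s ≡ 0
  d-self = ℕP.n≤0⇒n≡0 (proj₂ (isDist s s s∈V s∈V) 0 here)
  only-others : ∀ t → prob n d s t ≡ ind (not (eqPt s t)) ℚ.* prob n d s t
  only-others t with eqPt s t in e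
  ... | false = sym (ℚP.*-identityˡ _)
  ... | true with refl ← eqPt-true {s} {t} e =
    trans (cong (λ k → Zc n d s ℚ.* invSq k) d-self)
      (trans (ℚP.*-zeroʳ (Zc n d s)) (sym (ℚP.*-zeroˡ (prob n d s s))))

-- |V| ≤ 2 (2n+1)² ≤ 18 n²: a point of V is determined by its first two
-- coordinates and the sign of the third.
nonnegative? : ℤ → Bool
nonnegative? (+ _) = true
nonnegative? -[1+ _ ] = false

shadow : Pt → ℤ × ℤ × Bool
shadow (a , b , c) = (a , b , nonnegative? c)

shadow-injective : ∀ {n} p q → p ∈ Vs n → q ∈ Vs n → shadow p ≡ shadow q → p ≡ q
shadow-injective {n} (a , b , c) (a′ , b′ , c′) p∈ q∈ e with cong proj₁ e | cong (proj₁ ∘ proj₂) e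
... | refl | refl = cong (λ z → (a , b , z))
      (same-sign c c′ (cong (proj₂ ∘ proj₂) e)
        (ℕP.+-cancelˡ-≡ (∣ a ∣ ℕ.+ ∣ b ∣) _ _ (trans (Vs-sound {n} p∈) (sym (Vs-sound {n} q∈)))))
  where
  same-sign : ∀ c c′ → nonnegative? c ≡ nonnegative? c′ → ∣ c ∣ ≡ ∣ c′ ∣ → c ≡ c′
  same-sign (+ m) (+ m′) _ e = cong +_ e
  same-sign -[1+ m ] -[1+ m′ ] _ e = cong -[1+_] (ℕP.suc-injective e)

Σ-one-grid : ∀ {A B C : Set} (as : List A) (bs : List B) (cs : List C) →
  Σ (λ _ → 1ℚ) (grid as bs cs) ≡ ι (length as) ℚ.* (ι (length bs) ℚ.* (ι (length cs) ℚ.* 1ℚ))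
Σ-one-grid as bs cs = trans (Σ-grid (λ _ → 1ℚ) as bs cs)
  (trans (Σ-cong as (λ _ _ → trans (Σ-cong bs (λ _ _ → Σ-const 1ℚ cs)) (Σ-const _ bs))) (Σ-const _ as))

size-V : ∀ n → 1 ≤ n → ι (length (Vs n)) ℚ.≤ ι (18 ℕ.* n ℕ.* n)
size-V n 1≤n = begin
  ι (length (Vs n))
    ≤⟨ length-injection shadow (Vs n) Box (unique-Vs n) (shadow-injective {n}) shadow∈ ⟩
  ι (length Box)
    ≡⟨ trans (sym (trans (Σ-const 1ℚ Box) (ℚP.*-identityʳ _))) (Σ-one-grid (rangeZ n) (rangeZ n) signs) ⟩
  ι (length (rangeZ n)) ℚ.* (ι (length (rangeZ n)) ℚ.* (ι 2 ℚ.* 1ℚ))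
    ≡⟨ cong (λ m → ι m ℚ.* (ι m ℚ.* ι 2)) length-rangeZ ⟩
  ι N ℚ.* (ι N ℚ.* ι 2)
    ≡⟨ sym (trans (ι-* N (N ℕ.* 2)) (cong (ι N ℚ.*_) (ι-* N 2))) ⟩
  ι (N ℕ.* (N ℕ.* 2))
    ≤⟨ ι-mono (ℕP.≤-trans (ℕP.*-mono-≤ N≤3n (ℕP.*-monoˡ-≤ 2 N≤3n)) (ℕP.≤-reflexive (eighteen n))) ⟩
  ι (18 ℕ.* n ℕ.* n) ∎
  where
  open ℚP.≤-Reasoning
  N = suc (n ℕ.+ n)
  N≤3n : N ≤ 3 ℕ.* n
  N≤3n = subst₂ _≤_ (ℕP.+-comm (n ℕ.+ n) 1) (thrice n) (ℕP.+-monoʳ-≤ (n ℕ.+ n) 1≤n)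
    where
    thrice : ∀ n → n ℕ.+ n ℕ.+ n ≡ 3 ℕ.* n
    thrice = solve-∀
  eighteen : ∀ n → 3 ℕ.* n ℕ.* (3 ℕ.* n ℕ.* 2) ≡ 18 ℕ.* n ℕ.* n
  eighteen = solve-∀
  signs = true ∷ false ∷ []
  Box = grid (rangeZ n) (rangeZ n) signs
  length-rangeZ : length (rangeZ n) ≡ N
  length-rangeZ = trans (Data.List.Properties.length-map _ (upTo N)) (Data.List.Properties.length-upTo N)
  shadow∈ : ∀ p → p ∈ Vs n → shadow p ∈ Box
  shadow∈ (a , b , c) p∈ with coordinates-in-range {n} {a} {b} {c} (Vs-sound p∈)
  ... | a∈ , b∈ , _ = ∈-grid a∈ b∈ (sign∈ c)
    where
    sign∈ : ∀ c → nonnegative? c ∈ signs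
    sign∈ (+ _) = here refl
    sign∈ -[1+ _ ] = there (here refl)

-- The dyadic pairs: Σ (i + j)⁻² over them grows like the number of dyadic
-- scales.  Block k consists of the pairs 2^k ≤ i < 2^(k+1), 0 ≤ j < 2^k, all
-- with i + j ≤ 4·2^k, so each block contributes at least 1/16.

range : ℕ → ℕ → List ℕ
range a k = applyUpTo (a ℕ.+_) k

∈-range : ∀ {a k v} → v ∈ range a k → a ≤ v × v < a ℕ.+ k
∈-range {a} {k} m with ∈-applyUpTo⁻ (a ℕ.+_) m
... | i , i<k , refl = ℕP.m≤m+n a i , ℕP.+-monoʳ-< a i<k

unique-range : ∀ a k → Unique (range a k)
unique-range a k = Unique.applyUpTo⁺₁ (a ℕ.+_) k (λ i<j _ e → ℕP.<-irrefl (ℕP.+-cancelˡ-≡ a _ _ e) i<j)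

block : ℕ → List (ℕ × ℕ)
block k = concatMap (λ i → map (i ,_) (range 0 (2 ^ k))) (range (2 ^ k) (2 ^ k))

pairs : ℕ → List (ℕ × ℕ)
pairs zero = []
pairs (suc r) = pairs r ++ block r

∈-block : ∀ {k i j} → (i , j) ∈ block k → 2 ^ k ≤ i × i < 2 ^ k ℕ.+ 2 ^ k × j < 2 ^ k
∈-block {k} m with find (∈-concatMap⁻ (λ i → map (i ,_) (range 0 (2 ^ k))) {xs = range (2 ^ k) (2 ^ k)} m)
... | i , i∈ , m′ with ∈-map⁻ (i ,_) m′
... | j , j∈ , refl = proj₁ (∈-range i∈) , proj₂ (∈-range i∈) , proj₂ (∈-range j∈)

unique-block : ∀ k → Unique (block k)
unique-block k = unique-concatMap (λ i → map (i ,_) (range 0 (2 ^ k))) proj₁ (range (2 ^ k) (2 ^ k)) key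
  (λ i → unique-map (i ,_) (range 0 (2 ^ k)) (λ _ _ _ _ → cong proj₂) (unique-range 0 (2 ^ k)))
  (unique-range (2 ^ k) (2 ^ k))
  where
  key : ∀ i z → z ∈ map (i ,_) (range 0 (2 ^ k)) → proj₁ z ≡ i
  key i z m with ∈-map⁻ (i ,_) m
  ... | _ , _ , refl = refl

∈-pairs : ∀ {r i j} → (i , j) ∈ pairs r → 1 ≤ i × i < 2 ^ r × j < 2 ^ r
∈-pairs {suc r} m with ∈-++⁻ (pairs r) m
... | inj₁ m₁ with ∈-pairs {r} m₁
...   | 1≤i , i< , j< = 1≤i , grow i< , grow j<
  where
  grow : ∀ {x} → x < 2 ^ r → x < 2 ^ suc r
  grow x< = ℕP.<-≤-trans x< (ℕP.m≤m+n (2 ^ r) _)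
∈-pairs {suc r} {i} m | inj₂ m₂ with ∈-block {r} m₂
...   | M≤i , i< , j< = ℕP.≤-trans (ℕP.m^n>0 2 r) M≤i , subst (λ b → i < b) double i< ,
                        ℕP.<-≤-trans j< (ℕP.m≤m+n (2 ^ r) _)
  where
  double : 2 ^ r ℕ.+ 2 ^ r ≡ 2 ^ suc r
  double = cong (2 ^ r ℕ.+_) (sym (ℕP.+-identityʳ (2 ^ r)))

unique-pairs : ∀ r → Unique (pairs r)
unique-pairs zero = []
unique-pairs (suc r) = Unique.++⁺ (unique-pairs r) (unique-block r)
  (λ { (m₁ , m₂) → ℕP.<-irrefl refl (ℕP.<-≤-trans (proj₁ (proj₂ (∈-pairs {r} m₁))) (proj₁ (∈-block {r} m₂))) })

-- The weight (i + j)⁻² of a pair: a point at distance at most i + j from u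
-- contributes at least this much to the normalising mass of u.
pairWeight : ℕ × ℕ → ℚ
pairWeight (i , j) = invSq (i ℕ.+ j)

Σ-range-const : ∀ a k c → Σ (λ _ → c) (range a k) ≡ ι k ℚ.* c
Σ-range-const a k c = trans (Σ-const c (range a k)) (cong (λ l → ι l ℚ.* c) (Data.List.Properties.length-applyUpTo _ k))

Σ-block-const : ∀ k c → Σ (λ _ → c) (block k) ≡ ι (2 ^ k) ℚ.* (ι (2 ^ k) ℚ.* c)
Σ-block-const k c = trans (Σ-concatMap (λ _ → c) (λ i → map (i ,_) (range 0 M)) (range M M))
  (trans (Σ-cong (range M M) (λ i _ → trans (Σ-map (λ _ → c) (i ,_) (range 0 M)) (Σ-range-const 0 M c)))
         (Σ-range-const M M (ι M ℚ.* c)))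
  where M = 2 ^ k

block-weight : ∀ k → 1ℚ ℚ.≤ ι 16 ℚ.* Σ pairWeight (block k)
block-weight k = begin
  1ℚ
    ≡⟨ sym (invSq-inverse {4 ℕ.* M} (ℕP.*-mono-≤ {1} {4} (s≤s z≤n) (ℕP.m^n>0 2 k))) ⟩
  ι (4 ℕ.* M ℕ.* (4 ℕ.* M)) ℚ.* w
    ≡⟨ cong (ℚ._* w) (trans (cong ι (sixteen M)) (trans (ι-* 16 (M ℕ.* M)) (cong (ι 16 ℚ.*_) (ι-* M M)))) ⟩
  ι 16 ℚ.* (ι M ℚ.* ι M) ℚ.* w
    ≡⟨ reassociate (ι 16) (ι M) w ⟩
  ι 16 ℚ.* (ι M ℚ.* (ι M ℚ.* w))
    ≡⟨ cong (ι 16 ℚ.*_) (sym (Σ-block-const k w)) ⟩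
  ι 16 ℚ.* Σ (λ _ → w) (block k)
    ≤⟨ *-monoˡ (ι 16) (frac-nonneg 16 0) (Σ-mono (block k) smallest) ⟩
  ι 16 ℚ.* Σ pairWeight (block k) ∎
  where
  open ℚP.≤-Reasoning
  M = 2 ^ k
  w = invSq (4 ℕ.* M)
  sixteen : ∀ M → 4 ℕ.* M ℕ.* (4 ℕ.* M) ≡ 16 ℕ.* (M ℕ.* M)
  sixteen = solve-∀
  open +-*-Solver
  reassociate : ∀ a m w → a ℚ.* (m ℚ.* m) ℚ.* w ≡ a ℚ.* (m ℚ.* (m ℚ.* w))
  reassociate = solve 3 (λ a m w → a :* (m :* m) :* w := a :* (m :* (m :* w))) refl
  smallest : ∀ ij → ij ∈ block k → w ℚ.≤ pairWeight ij
  smallest (i , j) m with ∈-block {k} m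
  ... | M≤i , i< , j< = invSq-antitone (ℕP.≤-trans (ℕP.m^n>0 2 k) (ℕP.≤-trans M≤i (ℕP.m≤m+n i j)))
        (ℕP.≤-trans (ℕP.+-mono-≤ (ℕP.<⇒≤ i<) (ℕP.<⇒≤ (ℕP.<-≤-trans j< (ℕP.m≤m+n M M)))) (ℕP.≤-reflexive (four M)))
    where
    four : ∀ M → M ℕ.+ M ℕ.+ (M ℕ.+ M) ≡ 4 ℕ.* M
    four = solve-∀

dyadic-weight : ∀ r → ι r ℚ.≤ ι 16 ℚ.* Σ pairWeight (pairs r)
dyadic-weight zero = ≤-refl
dyadic-weight (suc r) = begin
  ι (suc r)                          ≡⟨ trans (ι-+ 1 r) (ℚP.+-comm 1ℚ (ι r)) ⟩
  ι r ℚ.+ 1ℚ                         ≤⟨ +-mono-≤ (dyadic-weight r) (block-weight r) ⟩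
  ι 16 ℚ.* Σ₁ ℚ.+ ι 16 ℚ.* Σ₂         ≡⟨ sym (ℚP.*-distribˡ-+ (ι 16) Σ₁ Σ₂) ⟩
  ι 16 ℚ.* (Σ₁ ℚ.+ Σ₂)               ≡⟨ cong (ι 16 ℚ.*_) (sym (Σ-++ pairWeight (pairs r) (block r))) ⟩
  ι 16 ℚ.* Σ pairWeight (pairs (suc r)) ∎
  where
  open ℚP.≤-Reasoning
  Σ₁ = Σ pairWeight (pairs r)
  Σ₂ = Σ pairWeight (block r)

-- Walks in G'_n that move one unit of mass between two coordinates: one
-- coordinate moves away from 0, another one towards 0, so the walk stays on V.

-- The unit pointing away from 0 (taken to be +1 at 0).
outward : ℤ → ℤ
outward (+ _) = 1ℤ
outward -[1+ _ ] = -1ℤ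

away : ℤ → ℤ
away x = outward x ℤ.+ x

toward : ℤ → ℤ
toward x = ℤ.- outward x ℤ.+ x

∣away∣ : ∀ x → ∣ away x ∣ ≡ suc ∣ x ∣
∣away∣ (+ m) = refl
∣away∣ -[1+ m ] = refl

∣toward∣ : ∀ x k → ∣ x ∣ ≡ suc k → ∣ toward x ∣ ≡ k
∣toward∣ (+ suc k) .k refl = refl
∣toward∣ -[1+ zero ] .zero refl = refl
∣toward∣ -[1+ suc m ] .(suc m) refl = refl

close-away : ∀ x → T (closeZ x (away x))
close-away x rewrite minus-shift x (outward x) with x
... | + _ = _
... | -[1+ _ ] = _

close-toward : ∀ x → T (closeZ x (toward x))
close-toward x rewrite minus-unshift x (outward x) with x
... | + _ = _
... | -[1+ _ ] = _

close-refl : ∀ x → T (closeZ x x)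
close-refl x rewrite ℤP.+-inverseʳ x = _

away-≢ : ∀ x → ¬ x ≡ away x
away-≢ x e = ℕP.<-irrefl (trans (cong ∣_∣ e) (∣away∣ x)) (ℕP.n<1+n ∣ x ∣)

adjacent : ∀ p q → ¬ p ≡ q → T (closeZ (proj₁ p) (proj₁ q)) → T (closeZ (proj₁ (proj₂ p)) (proj₁ (proj₂ q))) →
           T (closeZ (proj₂ (proj₂ p)) (proj₂ (proj₂ q))) → T (adj'B p q)
adjacent p q p≢q h₁ h₂ h₃ rewrite ≢⇒eqPt-false p q p≢q = ∧-intro h₁ (∧-intro h₂ h₃)

walk-++ : ∀ {n p q w k l} → Walk n p q k → Walk n q w l → Walk n p w (k ℕ.+ l)
walk-++ here w = w
walk-++ (step e q∈ w) w′ = step e q∈ (walk-++ w w′)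

walk-zero : ∀ {n p q} → Walk n p q 0 → p ≡ q
walk-zero here = refl

record Step (n : ℕ) (move : Pt → Pt) (g f₁ f₂ : Pt → ℕ) : Set where
  field
    stays : ∀ p k → norm1 p ≡ n → g p ≡ suc k →
      norm1 (move p) ≡ n × T (adj'B p (move p)) × g (move p) ≡ k × f₁ (move p) ≡ suc (f₁ p) × f₂ (move p) ≡ f₂ p

iterate : (Pt → Pt) → ℕ → Pt → Pt
iterate move zero p = p
iterate move (suc k) p = iterate move k (move p)

iterate-walk : ∀ {n move g f₁ f₂} → Step n move g f₁ f₂ → ∀ i p m → norm1 p ≡ n → g p ≡ i ℕ.+ m →
  Walk n p (iterate move i p) i × norm1 (iterate move i p) ≡ n × g (iterate move i p) ≡ m ×
  f₁ (iterate move i p) ≡ i ℕ.+ f₁ p × f₂ (iterate move i p) ≡ f₂ p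
iterate-walk S zero p m p∈ gp = here , p∈ , gp , refl , refl
iterate-walk {n} {move} {f₁ = f₁} S (suc i) p m p∈ gp with Step.stays S p (i ℕ.+ m) p∈ gp
... | q∈ , p~q , gq , f₁q , f₂q with iterate-walk S i (move p) m q∈ gq
... | walk , r∈ , gr , f₁r , f₂r =
  step p~q (ℕP.≡⇒≡ᵇ _ n q∈) walk , r∈ , gr ,
  trans f₁r (trans (cong (i ℕ.+_) f₁q) (ℕP.+-suc i (f₁ p))) , trans f₂r f₂q

∣a∣ ∣b∣ ∣c∣ : Pt → ℕ
∣a∣ (a , b , c) = ∣ a ∣
∣b∣ (a , b , c) = ∣ b ∣
∣c∣ (a , b , c) = ∣ c ∣

grow-a grow-b : Pt → Pt
grow-a (a , b , c) = (away a , b , toward c)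
grow-b (a , b , c) = (a , away b , toward c)

grow-a-step : ∀ n → Step n grow-a ∣c∣ ∣a∣ ∣b∣
Step.stays (grow-a-step n) (a , b , c) k p∈ c≡ =
  trans (cong₂ (λ x z → x ℕ.+ ∣ b ∣ ℕ.+ z) (∣away∣ a) (∣toward∣ c k c≡))
    (trans (shift ∣ a ∣ ∣ b ∣ k) (trans (cong (∣ a ∣ ℕ.+ ∣ b ∣ ℕ.+_) (sym c≡)) p∈)) ,
  adjacent (a , b , c) _ (λ e → away-≢ a (cong proj₁ e)) (close-away a) (close-refl b) (close-toward c) ,
  ∣toward∣ c k c≡ , ∣away∣ a , refl
  where
  shift : ∀ x y k → suc x ℕ.+ y ℕ.+ k ≡ x ℕ.+ y ℕ.+ suc k
  shift = solve-∀

grow-b-step : ∀ n → Step n grow-b ∣c∣ ∣b∣ ∣a∣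
Step.stays (grow-b-step n) (a , b , c) k p∈ c≡ =
  trans (cong₂ (λ y z → ∣ a ∣ ℕ.+ y ℕ.+ z) (∣away∣ b) (∣toward∣ c k c≡))
    (trans (shift ∣ a ∣ ∣ b ∣ k) (trans (cong (∣ a ∣ ℕ.+ ∣ b ∣ ℕ.+_) (sym c≡)) p∈)) ,
  adjacent (a , b , c) _ (λ e → away-≢ b (cong (proj₁ ∘ proj₂) e)) (close-refl a) (close-away b) (close-toward c) ,
  ∣toward∣ c k c≡ , ∣away∣ b , refl
  where
  shift : ∀ x y k → x ℕ.+ suc y ℕ.+ k ≡ x ℕ.+ y ℕ.+ suc k
  shift = solve-∀

record Spread (n : ℕ) (u : Pt) (r : ℕ) : Set where
  field
    point     : ℕ × ℕ → Pt
    on-V      : ∀ {ij} → ij ∈ pairs r → norm1 (point ij) ≡ n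
    not-u     : ∀ {ij} → ij ∈ pairs r → ¬ u ≡ point ij
    walk      : ∀ {ij} → ij ∈ pairs r → Walk n u (point ij) (proj₁ ij ℕ.+ proj₂ ij)
    injective : ∀ {ij kl} → ij ∈ pairs r → kl ∈ pairs r → point ij ≡ point kl → ij ≡ kl

-- When the third coordinate carries mass at least 2^(r+1), moving i units of
-- it to the first coordinate and then j units to the second gives a spread.
spread-from-third : ∀ {n u} r → norm1 u ≡ n → 2 ^ suc r ≤ ∣c∣ u → Spread n u r
spread-from-third {n} {u} r u∈ big = record
  { point = point ; on-V = λ m → proj₁ (proj₂ (moves m)) ; not-u = not-u
  ; walk = λ m → proj₁ (moves m) ; injective = injective }
  where
  point : ℕ × ℕ → Pt
  point (i , j) = iterate grow-b j (iterate grow-a i u)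
  fits : ∀ {i j} → (i , j) ∈ pairs r → i ℕ.+ j ≤ ∣c∣ u
  fits {i} {j} m with ∈-pairs {r} m
  ... | _ , i< , j< = ℕP.≤-trans (ℕP.<⇒≤ (ℕP.+-mono-< i< j<))
                        (subst (_≤ ∣c∣ u) (cong (2 ^ r ℕ.+_) (ℕP.+-identityʳ (2 ^ r))) big)
  moves : ∀ {ij} → ij ∈ pairs r →
    Walk n u (point ij) (proj₁ ij ℕ.+ proj₂ ij) × norm1 (point ij) ≡ n ×
    ∣a∣ (point ij) ≡ proj₁ ij ℕ.+ ∣a∣ u × ∣b∣ (point ij) ≡ proj₂ ij ℕ.+ ∣b∣ u
  moves {i , j} m
    with walk₁ , on₁ , c₁ , a₁ , b₁ ← iterate-walk (grow-a-step n) i u (j ℕ.+ (∣c∣ u ℕ.∸ (i ℕ.+ j))) u∈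
           (trans (sym (ℕP.m+[n∸m]≡n (fits m))) (ℕP.+-assoc i j _))
    with walk₂ , on₂ , _ , b₂ , a₂ ← iterate-walk (grow-b-step n) j _ _ on₁ c₁ =
    walk-++ walk₁ walk₂ , on₂ , trans a₂ a₁ , trans b₂ (cong (j ℕ.+_) b₁)
  not-u : ∀ {ij} → ij ∈ pairs r → ¬ u ≡ point ij
  not-u {i , j} m e = ℕP.<-irrefl refl (subst (∣a∣ u <_) (sym (trans (cong ∣a∣ e) (proj₁ (proj₂ (proj₂ (moves m))))))
                        (ℕP.+-monoˡ-≤ (∣a∣ u) (proj₁ (∈-pairs {r} m))))
  injective : ∀ {ij kl} → ij ∈ pairs r → kl ∈ pairs r → point ij ≡ point kl → ij ≡ kl
  injective {i , j} {k , l} m m′ e with moves m | moves m′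
  ... | _ , _ , a₁ , b₁ | _ , _ , a₂ , b₂ =
    cong₂ _,_ (ℕP.+-cancelʳ-≡ (∣a∣ u) i k (trans (sym a₁) (trans (cong ∣a∣ e) a₂)))
              (ℕP.+-cancelʳ-≡ (∣b∣ u) j l (trans (sym b₁) (trans (cong ∣b∣ e) b₂)))

-- The cyclic permutation of coordinates is a symmetry of G'_n, so spreads can
-- be transported along it: we may assume the third coordinate is the largest.
rotate : Pt → Pt
rotate (a , b , c) = (b , c , a)

rotate-norm : ∀ p → norm1 (rotate p) ≡ norm1 p
rotate-norm (a , b , c) = cycle (∣ a ∣) (∣ b ∣) (∣ c ∣)
  where
  cycle : ∀ x y z → y ℕ.+ z ℕ.+ x ≡ x ℕ.+ y ℕ.+ z
  cycle = solve-∀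

∧-rotate : ∀ x y z → y ∧ z ∧ x ≡ x ∧ y ∧ z
∧-rotate true y z = cong (y ∧_) (∧-identityʳ z)
∧-rotate false y z = trans (cong (y ∧_) (∧-zeroʳ z)) (∧-zeroʳ y)

rotate-adjacent : ∀ p q → adj'B (rotate p) (rotate q) ≡ adj'B p q
rotate-adjacent (a , b , c) (a′ , b′ , c′) =
  cong₂ (λ e c → not e ∧ c) (∧-rotate (eqZ a a′) (eqZ b b′) (eqZ c c′)) (∧-rotate (closeZ a a′) (closeZ b b′) (closeZ c c′))

rotate-walk : ∀ {n p q k} → Walk n p q k → Walk n (rotate p) (rotate q) k
rotate-walk here = here
rotate-walk {n} {p} (step {w = w} e w∈ walk) =
  step (subst T (sym (rotate-adjacent p w)) e) (subst (λ m → T (m ℕ.≡ᵇ n)) (sym (rotate-norm w)) w∈) (rotate-walk walk)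

spread-unrotate : ∀ {n u r} → Spread n (rotate u) r → Spread n u r
spread-unrotate S = record
  { point = λ ij → rotate (rotate (point ij))
  ; on-V = λ {ij} m → trans (rotate-norm (rotate (point ij))) (trans (rotate-norm (point ij)) (on-V m))
  ; not-u = λ m e → not-u m (cong rotate e)
  ; walk = λ m → rotate-walk (rotate-walk (walk m))
  ; injective = λ m m′ e → injective m m′ (cong rotate e) }
  where open Spread S

some-coordinate-large : ∀ {n a b c} → norm1 (a , b , c) ≡ n →
  ¬ n ≤ 3 ℕ.* ∣ a ∣ → ¬ n ≤ 3 ℕ.* ∣ b ∣ → ¬ n ≤ 3 ℕ.* ∣ c ∣ → ⊥
some-coordinate-large {n} {a} {b} {c} u∈ a< b< c< = ℕP.<-irrefl refl (begin-strict
  3 ℕ.* n                                         ≡⟨ cong (3 ℕ.*_) (sym u∈) ⟩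
  3 ℕ.* (∣ a ∣ ℕ.+ ∣ b ∣ ℕ.+ ∣ c ∣)               ≡⟨ spread-out (∣ a ∣) (∣ b ∣) (∣ c ∣) ⟩
  3 ℕ.* ∣ a ∣ ℕ.+ 3 ℕ.* ∣ b ∣ ℕ.+ 3 ℕ.* ∣ c ∣     <⟨ ℕP.+-mono-< (ℕP.+-mono-< (ℕP.≰⇒> a<) (ℕP.≰⇒> b<)) (ℕP.≰⇒> c<) ⟩
  n ℕ.+ n ℕ.+ n                                   ≡⟨ thrice n ⟩
  3 ℕ.* n ∎)
  where
  open ℕP.≤-Reasoning
  spread-out : ∀ x y z → 3 ℕ.* (x ℕ.+ y ℕ.+ z) ≡ 3 ℕ.* x ℕ.+ 3 ℕ.* y ℕ.+ 3 ℕ.* z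
  spread-out = solve-∀
  thrice : ∀ n → n ℕ.+ n ℕ.+ n ≡ 3 ℕ.* n
  thrice = solve-∀

spread : ∀ {n u} r → norm1 u ≡ n → 3 ℕ.* 2 ^ suc r ≤ n → Spread n u r
spread {n} {u@(a , b , c)} r u∈ small with n ℕ.≤? 3 ℕ.* ∣ c ∣ | n ℕ.≤? 3 ℕ.* ∣ a ∣ | n ℕ.≤? 3 ℕ.* ∣ b ∣
... | yes big | _ | _ = spread-from-third r u∈ (ℕP.*-cancelˡ-≤ 3 (ℕP.≤-trans small big))
... | no _ | yes big | _ =
  spread-unrotate (spread-from-third r (trans (rotate-norm u) u∈) (ℕP.*-cancelˡ-≤ 3 (ℕP.≤-trans small big)))
... | no _ | no _ | yes big =
  spread-unrotate (spread-unrotate (spread-from-third r (trans (rotate-norm (rotate u)) (trans (rotate-norm u) u∈))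
    (ℕP.*-cancelˡ-≤ 3 (ℕP.≤-trans small big))))
... | no c< | no a< | no b< = ⊥-elim (some-coordinate-large {n} {a} {b} {c} u∈ a< b< c<)

-- A spread bounds the normalising mass from below: its point for (i , j) is
-- at distance between 1 and i + j from u.
spread-mass : ∀ {n d u r} → IsDistance n d → norm1 u ≡ n → Spread n u r → ι r ℚ.≤ ι 16 ℚ.* mass n d u
spread-mass {n} {d} {u} {r} isDist u∈ S = begin
  ι r                                              ≤⟨ dyadic-weight r ⟩
  ι 16 ℚ.* Σ pairWeight (pairs r)                  ≤⟨ *-monoˡ (ι 16) (frac-nonneg 16 0) (Σ-mono (pairs r) closer) ⟩
  ι 16 ℚ.* Σ (λ ij → invSq (d u (point ij))) (pairs r)
    ≡⟨ cong (ι 16 ℚ.*_) (sym (Σ-map (λ w → invSq (d u w)) point (pairs r))) ⟩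
  ι 16 ℚ.* Σ (λ w → invSq (d u w)) (map point (pairs r))
    ≤⟨ *-monoˡ (ι 16) (frac-nonneg 16 0)
         (Σ-sublist (λ w → invSq (d u w)) _ (others n u) (unique-map point (pairs r) (λ _ _ → injective) (unique-pairs r))
           in-others (λ w _ → invSq-nonneg (d u w))) ⟩
  ι 16 ℚ.* mass n d u ∎
  where
  open ℚP.≤-Reasoning
  open Spread S
  u∈V : T (inV n u)
  u∈V = ℕP.≡⇒≡ᵇ _ n u∈
  closer : ∀ ij → ij ∈ pairs r → pairWeight ij ℚ.≤ invSq (d u (point ij))
  closer ij m with isDist u (point ij) u∈V (ℕP.≡⇒≡ᵇ _ n (on-V m))
  ... | shortest , minimal = invSq-antitone (positive (d u (point ij)) shortest) (minimal _ (walk m))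
    where
    positive : ∀ k → Walk n u (point ij) k → 1 ≤ k
    positive zero w = ⊥-elim (not-u m (walk-zero w))
    positive (suc k) _ = s≤s z≤n
  in-others : ∀ w → w ∈ map point (pairs r) → w ∈ others n u
  in-others w m with ∈-map⁻ point m
  ... | ij , ij∈ , refl = ∈-others {n} {u} {point ij} (Vs-complete (on-V ij∈)) (not-u ij∈)

2^⌊log₂⌋≤ : ∀ n → 1 ≤ n → 2 ^ ⌊log₂ n ⌋ ≤ n
2^⌊log₂⌋≤ = <-rec (λ n → 1 ≤ n → 2 ^ ⌊log₂ n ⌋ ≤ n) halving
  where
  halving : ∀ n → (∀ {m} → m < n → 1 ≤ m → 2 ^ ⌊log₂ m ⌋ ≤ m) → 1 ≤ n → 2 ^ ⌊log₂ n ⌋ ≤ n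
  halving (suc zero) _ _ = ℕP.≤-refl
  halving n@(suc (suc k)) smaller _ = begin
    2 ^ ⌊log₂ n ⌋
      ≡⟨ cong (2 ^_) (sym (ℕP.m+[n∸m]≡n (⌊log₂⌋-mono-≤ {2} {n} (s≤s (s≤s z≤n))))) ⟩
    2 ℕ.* 2 ^ (⌊log₂ n ⌋ ℕ.∸ 1)
      ≡⟨ cong (λ e → 2 ℕ.* 2 ^ e) (sym (⌊log₂⌊n/2⌋⌋≡⌊log₂n⌋∸1 n)) ⟩
    2 ℕ.* 2 ^ ⌊log₂ ⌊ n /2⌋ ⌋
      ≤⟨ ℕP.*-monoʳ-≤ 2 (smaller (ℕP.⌊n/2⌋<n (suc k)) (s≤s z≤n)) ⟩
    ⌊ n /2⌋ ℕ.+ (⌊ n /2⌋ ℕ.+ 0)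
      ≤⟨ ℕP.+-monoʳ-≤ ⌊ n /2⌋ (ℕP.≤-trans (ℕP.≤-reflexive (ℕP.+-identityʳ _)) (ℕP.⌊n/2⌋≤⌈n/2⌉ n)) ⟩
    ⌊ n /2⌋ ℕ.+ ℕ.⌈ n /2⌉
      ≡⟨ ℕP.⌊n/2⌋+⌈n/2⌉≡n n ⟩
    n ∎
    where open ℕP.≤-Reasoning

-- With r = ⌊log₂ n⌋ - 3 dyadic scales, every s ∈ V has a spread of order r,
-- so the normalising mass of s is at least ⌊log₂ n⌋ / 64.
log-mass : ∀ n d → IsDistance n d → 16 ≤ n → ∀ {s} → s ∈ Vs n → ι ⌊log₂ n ⌋ ℚ.≤ ι 64 ℚ.* mass n d s
log-mass n d isDist 16≤n {s} s∈ = begin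
  ι L
    ≤⟨ ι-mono (subst (_≤ 4 ℕ.* r) L≡ (ℕP.≤-trans (ℕP.+-monoˡ-≤ r (ℕP.*-monoʳ-≤ 3 r≥1)) (ℕP.≤-reflexive (four r)))) ⟩
  ι (4 ℕ.* r)
    ≡⟨ ι-* 4 r ⟩
  ι 4 ℚ.* ι r
    ≤⟨ *-monoˡ (ι 4) (frac-nonneg 4 0) (spread-mass isDist (Vs-sound s∈) (spread r (Vs-sound s∈) small)) ⟩
  ι 4 ℚ.* (ι 16 ℚ.* mass n d s)
    ≡⟨ sym (ℚP.*-assoc (ι 4) (ι 16) (mass n d s)) ⟩
  ι 64 ℚ.* mass n d s ∎
  where
  open ℚP.≤-Reasoning
  L = ⌊log₂ n ⌋
  r = L ℕ.∸ 3
  L≥4 : 4 ≤ L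
  L≥4 = ⌊log₂⌋-mono-≤ {16} {n} 16≤n
  L≡ : 3 ℕ.+ r ≡ L
  L≡ = ℕP.m+[n∸m]≡n (ℕP.≤-trans (ℕP.n≤1+n 3) L≥4)
  r≥1 : 1 ≤ r
  r≥1 = ℕP.+-cancelˡ-≤ 3 1 r (subst (4 ≤_) (sym L≡) L≥4)
  four : ∀ r → 3 ℕ.* r ℕ.+ r ≡ 4 ℕ.* r
  four = solve-∀
  eight : ∀ x → 4 ℕ.* (2 ℕ.* x) ≡ 2 ℕ.* (2 ℕ.* (2 ℕ.* x))
  eight = solve-∀
  small : 3 ℕ.* 2 ^ suc r ≤ n
  small = ℕP.≤-trans (ℕP.*-monoˡ-≤ (2 ^ suc r) {3} {4} (ℕP.n≤1+n 3))
            (ℕP.≤-trans (ℕP.≤-reflexive (trans (eight (2 ^ r)) (cong (2 ^_) L≡)))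
                        (2^⌊log₂⌋≤ n (ℕP.≤-trans (s≤s z≤n) 16≤n)))

prob-log : ∀ n d → IsDistance n d → 16 ≤ n → ∀ {s} t → s ∈ Vs n → prob n d s t ℚ.* ι ⌊log₂ n ⌋ ℚ.≤ ι 64
prob-log n d isDist 16≤n {s} t s∈ = begin
  prob n d s t ℚ.* ι L                ≤⟨ *-monoʳ (ι L) (frac-nonneg L 0) (prob-≤-Z n d s t) ⟩
  Z ℚ.* ι L                           ≤⟨ *-monoˡ Z (Z-nonneg n d s) (log-mass n d isDist 16≤n s∈) ⟩
  Z ℚ.* (ι 64 ℚ.* mass n d s)         ≡⟨ swap Z (ι 64) (mass n d s) ⟩
  ι 64 ℚ.* (Z ℚ.* mass n d s)         ≤⟨ *-monoˡ (ι 64) (frac-nonneg 64 0) (recip-* (mass n d s)) ⟩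
  ι 64 ℚ.* 1ℚ                         ≡⟨ ℚP.*-identityʳ (ι 64) ⟩
  ι 64 ∎
  where
  open ℚP.≤-Reasoning
  L = ⌊log₂ n ⌋
  Z = Zc n d s
  open +-*-Solver
  swap : ∀ a b c → a ℚ.* (b ℚ.* c) ≡ b ℚ.* (a ℚ.* c)
  swap = solve 3 (λ a b c → a :* (b :* c) := b :* (a :* c)) refl

module _ (n : ℕ) (d : Pt → Pt → ℕ) (isDist : IsDistance n d) where

  arcBound-row : ∀ {s} → s ∈ Vs n → Σ (arcBound n d s) (Vs n) ℚ.≤ ι 28
  arcBound-row {s} s∈ = ≤-trans (≤-reflexive (Σ-+ (λ t → ind (adj'B s t)) (prob n d s) (Vs n)))
                                (+-mono-≤ (adjacency-row n s) (prob-row n d isDist s∈))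

  -- Each family of triangles with a prescribed long-range arc contributes
  -- O(|V| / log n): two arcs have bounded row sums, the long one is O(1 / log n).
  closing-sum : 16 ≤ n →
    Σ³ (Vs n) (closing n d) ℚ.* ι ⌊log₂ n ⌋ ℚ.≤ ι (length (Vs n)) ℚ.* (ι 28 ℚ.* (ι 28 ℚ.* ι 64))
  closing-sum 16≤n = begin
    Σ³ (Vs n) (closing n d) ℚ.* ι L
      ≡⟨ trans (Σ³-*ʳ (Vs n) (closing n d) (ι L))
               (Σ-cong (Vs n) (λ u _ → Σ-cong (Vs n) (λ x _ → Σ-cong (Vs n) (λ y _ →
                  ℚP.*-assoc (arcBound n d u x ℚ.* arcBound n d x y) (prob n d y u) (ι L))))) ⟩
    Σ³ (Vs n) (λ u x y → arcBound n d u x ℚ.* arcBound n d x y ℚ.* (prob n d y u ℚ.* ι L))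
      ≤⟨ Σ³-path (Vs n) (arcBound n d) (arcBound n d) (λ y u → prob n d y u ℚ.* ι L) (ι 28) (ι 28) (ι 64)
           (λ {s} {t} _ _ → arcBound-nonneg n d s t) (λ {s} {t} _ _ → arcBound-nonneg n d s t)
           arcBound-row arcBound-row (λ {s} {t} s∈ _ → prob-log n d isDist 16≤n t s∈)
           (frac-nonneg 28 0) (frac-nonneg 64 0) ⟩
    ι (length (Vs n)) ℚ.* (ι 28 ℚ.* (ι 28 ℚ.* ι 64)) ∎
    where
    open ℚP.≤-Reasoning
    L = ⌊log₂ n ⌋

cycleBound-rotations : ∀ n d → Σ³ (Vs n) (cycleBound n d) ≡
  Σ³ (Vs n) (closing n d) ℚ.+ Σ³ (Vs n) (closing n d) ℚ.+ Σ³ (Vs n) (closing n d)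
cycleBound-rotations n d = trans (Σ³-+ V _ (closing n d))
  (cong (ℚ._+ Σ³ V (closing n d)) (trans (Σ³-+ V _ _)
    (cong₂ ℚ._+_ (Σ³-rotate V (closing n d))
                 (trans (Σ³-rotate V (λ x y u → closing n d y u x)) (Σ³-rotate V (closing n d))))))
  where V = Vs n

-- E[X] · ⌊log₂ n⌋ ≤ 3 · 28 · 28 · 64 · |V|.
EX-log : ∀ n d → IsDistance n d → 16 ≤ n → EX n d ℚ.* ι ⌊log₂ n ⌋ ℚ.≤ ι (length (Vs n)) ℚ.* ι 150528
EX-log n d isDist 16≤n = begin
  EX n d ℚ.* ι L                           ≤⟨ *-monoʳ (ι L) (frac-nonneg L 0) (EX-≤ n d) ⟩
  Σ³ (Vs n) (cycleBound n d) ℚ.* ι L       ≡⟨ trans (cong (ℚ._* ι L) (cycleBound-rotations n d)) (distribute S (ι L)) ⟩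
  S ℚ.* ι L ℚ.+ S ℚ.* ι L ℚ.+ S ℚ.* ι L     ≤⟨ +-mono-≤ (+-mono-≤ family family) family ⟩
  v ℚ.* c ℚ.+ v ℚ.* c ℚ.+ v ℚ.* c           ≡⟨ collect v c ⟩
  v ℚ.* (c ℚ.+ c ℚ.+ c)                    ≡⟨⟩
  v ℚ.* ι 150528 ∎
  where
  open ℚP.≤-Reasoning
  L = ⌊log₂ n ⌋
  S = Σ³ (Vs n) (closing n d)
  v = ι (length (Vs n))
  c = ι 28 ℚ.* (ι 28 ℚ.* ι 64)
  family : S ℚ.* ι L ℚ.≤ v ℚ.* c
  family = closing-sum n d isDist 16≤n
  open +-*-Solver
  distribute : ∀ s l → (s ℚ.+ s ℚ.+ s) ℚ.* l ≡ s ℚ.* l ℚ.+ s ℚ.* l ℚ.+ s ℚ.* l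
  distribute = solve 2 (λ s l → (s :+ s :+ s) :* l := s :* l :+ s :* l :+ s :* l) refl
  collect : ∀ v c → v ℚ.* c ℚ.+ v ℚ.* c ℚ.+ v ℚ.* c ≡ v ℚ.* (c ℚ.+ c ℚ.+ c)
  collect = solve 2 (λ v c → v :* c :+ v :* c :+ v :* c := v :* (c :+ c :+ c)) refl

theorem4 : ∃ λ (C : ℕ) → ∃ λ (N : ℕ) → ∀ (n : ℕ) → N ≤ n → 1 ≤ n →
    ∀ (d : Pt → Pt → ℕ) → IsDistance n d →
    EX n d ℚ.* (+ ⌊log₂ n ⌋ / 1) ℚ.≤ (+ (C * n * n) / 1)
theorem4 = 18 * 150528 , 16 , λ n 16≤n 1≤n d isDist → begin
  EX n d ℚ.* ι ⌊log₂ n ⌋                 ≤⟨ EX-log n d isDist 16≤n ⟩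
  ι (length (Vs n)) ℚ.* ι 150528          ≤⟨ *-monoʳ (ι 150528) (frac-nonneg 150528 0) (size-V n 1≤n) ⟩
  ι (18 * n * n) ℚ.* ι 150528             ≡⟨ sym (ι-* (18 * n * n) 150528) ⟩
  ι (18 * n * n * 150528)                 ≡⟨ cong ι (constant n) ⟩
  ι (18 * 150528 * n * n) ∎
  where
  open ℚP.≤-Reasoning
  constant : ∀ n → 18 * n * n * 150528 ≡ 18 * 150528 * n * n
  constant = solve-∀
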